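{- Let $\mathfrak M_n^R$ be the set of permutations $\pi\in S_n$ that avoid the pattern $231$ and the generalized pattern $32\text{ - }1$. Then $$\sum_{n\ge0}\sum_{\pi\in\mathfrak M_n^R}w^{\mathrm{fp}(\pi)}x^n =\cfrac{1}{1-wx-\cfrac{x^2}{1-x-M_0(w-1)x^2-\cfrac{x^2}{1-x-M_1(w-1)x^3-\cfrac{x^2}{1-x-M_2(w-1)x^4-\cfrac{x^2}{\ddots}}}}},$$ i.e. after the first level $1-wx$, the $(j+1)$-st level is $1-x-M_j(w-1)x^{j+2}$ for $j=0,1,2,\dots$, all partial numerators being $x^2$.
   Context: A permutation $\pi\in S_n$ avoids $231$ if there are no $i<j<k$ with $\pi_k<\pi_i<\pi_j$; it avoids $32\text{ - }1$ if there are no indices $a<b$ with $\pi_{a-1}>\pi_a>\pi_b$ (equivalently, $\pi$ is in $\mathfrak M_n^R$ iff its reversal $\pi_n\cdots\pi_1$ avoids $132$ and has no $a<b$ with $\pi_a<\pi_b<\pi_{b+1}$). $\mathrm{fp}(\pi)$ is the number of fixed points of $\pi$, i.e. indices $i$ with $\pi_i=i$. $M_n$ is the $n$-th Motzkin number (number of lattice paths from $(0,0)$ to $(n,0)$ with steps $(1,1),(1,-1),(1,0)$ never going below the $x$-axis); $M_0=1,M_1=1,M_2=2,\dots$. -}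

module Defs where

open import Data.Nat as ℕ using (ℕ; zero; suc; _∸_)
open import Data.Integer as ℤ using (ℤ; +_)
open import Data.Fin using (Fin; toℕ) renaming (_<_ to _<ᶠ_)
open import Data.List using (List; []; _∷_; length; lookup; upTo)
open import Data.List.Membership.Propositional using (_∈_)
open import Data.List.Relation.Unary.Unique.Propositional using (Unique)
open import Data.List.Relation.Binary.Permutation.Propositional using (_↭_)
open import Data.Product using (Σ; Σ-syntax; ∃; ∃-syntax; _×_)
open import Data.Bool using (if_then_else_; _∧_)
open import Relation.Nullary using (¬_; does)
open import Relation.Binary.PropositionalEquality using (_≡_)
open import Function.Bundles using (_⇔_)

-- Permutations in one-line notation, 0-indexed:
-- an element of S_n is a list π with π ↭ [0, 1, …, n-1];
-- position i (0-based) holds the value π_i.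

IsPerm : ℕ → List ℕ → Set
IsPerm n π = π ↭ upTo n

Contains231 : List ℕ → Set
Contains231 π = Σ[ i ∈ Fin (length π) ] Σ[ j ∈ Fin (length π) ] Σ[ k ∈ Fin (length π) ]
  (i <ᶠ j × j <ᶠ k × lookup π k ℕ.< lookup π i × lookup π i ℕ.< lookup π j)

Contains32-1 : List ℕ → Set
Contains32-1 π = Σ[ i ∈ Fin (length π) ] Σ[ a ∈ Fin (length π) ] Σ[ b ∈ Fin (length π) ]
  (toℕ a ≡ suc (toℕ i) × a <ᶠ b × lookup π a ℕ.< lookup π i × lookup π b ℕ.< lookup π a)

InMR : ℕ → List ℕ → Set
InMR n π = IsPerm n π × ¬ Contains231 π × ¬ Contains32-1 π

-- number of fixed points (0-indexed: positions i with π_i = i)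
fpFrom : ℕ → List ℕ → ℕ
fpFrom i []       = 0
fpFrom i (x ∷ xs) = (if does (x ℕ.≟ i) then 1 else 0) ℕ.+ fpFrom (suc i) xs

fp : List ℕ → ℕ
fp = fpFrom 0

HasCount : (List ℕ → Set) → ℕ → Set
HasCount P c = Σ[ L ∈ List (List ℕ) ] (Unique L × (∀ π → (π ∈ L) ⇔ P π) × length L ≡ c)

-- Motzkin numbers as lattice path counts.
-- paths n h = number of paths of n steps U=(1,1), D=(1,-1), F=(1,0),
-- starting at height h, ending at height 0, never going below 0.

paths : ℕ → ℕ → ℕ
paths zero    zero    = 1
paths zero    (suc h) = 0
paths (suc n) zero    = paths n 1 ℕ.+ paths n 0
paths (suc n) (suc h) = paths n (suc (suc h)) ℕ.+ paths n (suc h) ℕ.+ paths n h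

Motzkin : ℕ → ℕ
Motzkin n = paths n 0

-- Formal power series in x with coefficients in ℤ[w]:
-- s n k = coefficient of x^n w^k.

Series : Set
Series = ℕ → ℕ → ℤ

_≈ˢ_ : Series → Series → Set
f ≈ˢ g = ∀ n k → f n k ≡ g n k

sumTo : ℕ → (ℕ → ℤ) → ℤ
sumTo zero    f = f 0
sumTo (suc n) f = sumTo n f ℤ.+ f (suc n)

_+ˢ_ : Series → Series → Series
(f +ˢ g) n k = f n k ℤ.+ g n k

_-ˢ_ : Series → Series → Series
(f -ˢ g) n k = f n k ℤ.- g n k

_*ˢ_ : Series → Series → Series
(f *ˢ g) n k = sumTo n λ i → sumTo k λ j → f i j ℤ.* g (n ∸ i) (k ∸ j)

mono : ℤ → ℕ → ℕ → Series
mono c a b n k = if does (n ℕ.≟ a) ∧ does (k ℕ.≟ b) then c else + 0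

oneˢ : Series
oneˢ = mono (+ 1) 0 0

X W : Series
X = mono (+ 1) 1 0
W = mono (+ 1) 0 1

fromℕ² : (ℕ → ℕ → ℕ) → Series
fromℕ² a n k = + (a n k)

level₀ : Series → Series
level₀ T = ((oneˢ -ˢ (W *ˢ X)) -ˢ (mono (+ 1) 2 0 *ˢ T))

levelₛ : ℕ → Series → Series
levelₛ j T =
  (((oneˢ -ˢ X) -ˢ (mono (+ Motzkin j) (j ℕ.+ 2) 0 *ˢ (W -ˢ oneˢ)))
    -ˢ (mono (+ 1) 2 0 *ˢ T))

-- Let F_d(x, w) be the generating function of 𝔐ᴿ_n by the number of entries π_i = i + d, so that
-- F_0 is the series of the theorem. A permutation in 𝔐ᴿ_{n+1} either starts with its minimum 0, or
-- has the form (m+1) 0 A B with A an arrangement of 1, …, m and B one of m+2, …, n, both avoiding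
-- the patterns: the second entry must be 0 (otherwise the first two entries and 0 form a 231 or a
-- 32-1), and every entry below the first one precedes every entry above it (otherwise 231).
-- Following the shifted fixed points through this decomposition gives
--   F_d = 1 + w^[d=0] x F_d + x² F_d F̃_{d+1},
-- where F̃_{d+1} is F_{d+1} with its coefficient of x^{d-1} multiplied by w, the first entry m+1
-- being counted exactly when m + 1 = d. An arrangement of length d - 1 has no entry π_i = i + d + 1,
-- so that coefficient is |𝔐ᴿ_{d-1}|, and for d large the same recurrence shows that |𝔐ᴿ_n|
-- satisfies the recurrence of the Motzkin numbers. Hence F_0 (1 - wx - x² F_1) = 1 and
-- F_{j+1} (1 - x - M_j (w - 1) x^{j+2} - x² F_{j+2}) = 1, i.e. G_j = F_{j+1} are the tails of the
-- continued fraction.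

module Submission where

open import Defs
open import Data.Nat using (ℕ; zero; suc; _+_; _*_; _∸_; _≤_; _<_; _≟_; _≤?_; _<?_; z≤n; s≤s)
open import Data.Nat.Properties
open import Algebra.Properties.CommutativeSemigroup +-commutativeSemigroup using () renaming (interchange to +-interchange)
open import Data.Integer using (ℤ; +_; 0ℤ)
import Data.Integer as ℤ
import Data.Integer.Properties as ℤₚ
open import Data.Integer.Tactic.RingSolver using (solve-∀)
open import Data.Fin as Fin using (Fin) renaming (_<_ to _<ᶠ_)
open import Data.Bool using (true; false; if_then_else_; _∧_)
open import Data.Bool.Properties using (∧-zeroʳ)
open import Data.Unit using (tt)
open import Data.Empty using (⊥; ⊥-elim)
open import Data.Product using (∃-syntax; Σ-syntax; _×_; _,_; proj₁; proj₂; swap)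
open import Data.Sum using (_⊎_; inj₁; inj₂; [_,_])
open import Data.Maybe.Relation.Unary.All as MaybeAll using (just)
open import Data.List
  using (List; []; _∷_; _++_; length; lookup; head; map; concat; applyUpTo; cartesianProductWith;
         takeWhile; dropWhile; filter)
open import Data.List.Properties using (takeWhile++dropWhile; length-applyUpTo; ∷-injective; ∷-injectiveˡ; ∷-injectiveʳ)
open import Data.List.Relation.Unary.Any as Any using (Any; here; there)
import Data.List.Relation.Unary.Any.Properties as Anyₚ
open import Data.List.Relation.Unary.All as All using (All; []; _∷_)
import Data.List.Relation.Unary.All.Properties as Allₚ
open import Data.List.Relation.Unary.All.Properties using (¬Any⇒All¬)
open import Data.List.Relation.Unary.AllPairs using ([]; _∷_)
import Data.List.Relation.Unary.AllPairs.Properties as AllPairsₚ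
open import Data.List.Relation.Unary.Unique.Propositional using (Unique)
import Data.List.Relation.Unary.Unique.Propositional.Properties as Uniqueₚ
open import Data.List.Membership.Propositional using (_∈_; lose)
open import Data.List.Membership.Propositional.Properties
  using (∈-lookup; ∈-++⁺ˡ; ∈-++⁺ʳ; ∈-++⁻; ∈-map⁺; ∈-map⁻; ∈-concat⁺′; ∈-concat⁻′; ∈-applyUpTo⁺; ∈-applyUpTo⁻;
         ∈-cartesianProductWith⁺; ∈-cartesianProductWith⁻; ∈-filter⁺; ∈-filter⁻; ∈-upTo⁺; ∈-upTo⁻)
open import Data.List.Membership.Propositional.Properties.WithK using (unique∧set⇒bag)
open import Data.List.Relation.Binary.BagAndSetEquality using (∼bag⇒↭)
open import Data.List.Relation.Binary.Permutation.Propositional using (_↭_; ↭-sym; ↭⇒↭ₛ)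
open import Data.List.Relation.Binary.Permutation.Propositional.Properties using (∈-resp-↭; ↭-length)
open import Data.List.Relation.Binary.Permutation.Setoid.Properties using (Unique-resp-↭)
open import Function using (_∘_)
open import Function.Bundles using (_⇔_; Equivalence; mk⇔)
open import Relation.Nullary using (¬_; yes; no; does)
open import Relation.Nullary.Decidable using (dec-true; dec-false)
open import Relation.Unary using (Decidable)
open import Relation.Binary.Definitions using (tri<; tri≈; tri>)
open import Relation.Binary.PropositionalEquality hiding ([_])

shift : {A : Set} → A → ℕ → (ℕ → A) → ℕ → A
shift z zero    h n       = h n
shift z (suc a) h zero    = z
shift z (suc a) h (suc n) = shift z a h n

module _ {A : Set} {z : A} where

  shift-≥ : ∀ a h {n} → a ≤ n → shift z a h n ≡ h (n ∸ a)
  shift-≥ zero    h _       = refl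
  shift-≥ (suc a) h (s≤s p) = shift-≥ a h p

  shift-< : ∀ a h {n} → n < a → shift z a h n ≡ z
  shift-< (suc a) h {zero}  _       = refl
  shift-< (suc a) h {suc n} (s≤s p) = shift-< a h p

  shift-cong : ∀ a {g h : ℕ → A} → (∀ m → g m ≡ h m) → ∀ n → shift z a g n ≡ shift z a h n
  shift-cong zero    eq n       = eq n
  shift-cong (suc a) eq zero    = refl
  shift-cong (suc a) eq (suc n) = shift-cong a eq n

  shift-shift : ∀ a b h n → shift z a (shift z b h) n ≡ shift z (a + b) h n
  shift-shift zero    b h n       = refl
  shift-shift (suc a) b h zero    = refl
  shift-shift (suc a) b h (suc n) = shift-shift a b h n

  shift-padding : ∀ a n → shift z a (λ _ → z) n ≡ z
  shift-padding zero    n       = refl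
  shift-padding (suc a) zero    = refl
  shift-padding (suc a) (suc n) = shift-padding a n

shift-commute : ∀ {J A B : Set} {z : A} {z′ : B} (op : (J → A) → B) → op (λ _ → z) ≡ z′ →
                ∀ a (h : J → ℕ → A) n →
                op (λ j → shift z a (h j) n) ≡ shift z′ a (λ m → op (λ j → h j m)) n
shift-commute op op-z zero    h n       = refl
shift-commute op op-z (suc a) h zero    = op-z
shift-commute op op-z (suc a) h (suc n) = shift-commute op op-z a h n

shift-map : ∀ {A B : Set} {z : A} {z′ : B} (φ : A → B) → φ z ≡ z′ →
            ∀ a h n → φ (shift z a h n) ≡ shift z′ a (λ m → φ (h m)) n
shift-map φ φ-z a h = shift-commute (λ v → φ (v tt)) φ-z a (λ _ → h)

shift-zipWith : ∀ {A : Set} {z : A} (_∙_ : A → A → A) → z ∙ z ≡ z →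
                ∀ a g h n → shift z a g n ∙ shift z a h n ≡ shift z a (λ m → g m ∙ h m) n
shift-zipWith _∙_ z∙z zero    g h n       = refl
shift-zipWith _∙_ z∙z (suc a) g h zero    = z∙z
shift-zipWith _∙_ z∙z (suc a) g h (suc n) = shift-zipWith _∙_ z∙z a g h n

shiftℤ : ℕ → (ℕ → ℤ) → ℕ → ℤ
shiftℤ = shift 0ℤ

shiftℕ : ℕ → (ℕ → ℕ) → ℕ → ℕ
shiftℕ = shift 0

+-shiftℕ : ∀ a h n → + shiftℕ a h n ≡ shiftℤ a (λ m → + h m) n
+-shiftℕ = shift-map +_ refl

δ : ℕ → ℕ → ℕ
δ x y = if does (x ≟ y) then 1 else 0

δ-refl : ∀ x → δ x x ≡ 1
δ-refl x = cong (λ t → if t then 1 else 0) (dec-true (x ≟ x) refl)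

δ-≢ : ∀ {x y} → x ≢ y → δ x y ≡ 0
δ-≢ {x} {y} x≢y = cong (λ t → if t then 1 else 0) (dec-false (x ≟ y) x≢y)

sumTo-cong : ∀ n {φ ψ : ℕ → ℤ} → (∀ i → i ≤ n → φ i ≡ ψ i) → sumTo n φ ≡ sumTo n ψ
sumTo-cong zero    eq = eq 0 z≤n
sumTo-cong (suc n) eq = cong₂ ℤ._+_ (sumTo-cong n (λ i i≤n → eq i (m≤n⇒m≤1+n i≤n))) (eq (suc n) ≤-refl)

sumTo-zero : ∀ n {φ : ℕ → ℤ} → (∀ i → i ≤ n → φ i ≡ 0ℤ) → sumTo n φ ≡ 0ℤ
sumTo-zero zero    eq = eq 0 z≤n
sumTo-zero (suc n) eq = cong₂ ℤ._+_ (sumTo-zero n (λ i i≤n → eq i (m≤n⇒m≤1+n i≤n))) (eq (suc n) ≤-refl)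

sumTo-single : ∀ {a} n {φ : ℕ → ℤ} → a ≤ n → (∀ i → i ≤ n → i ≢ a → φ i ≡ 0ℤ) → sumTo n φ ≡ φ a
sumTo-single zero    z≤n _ = refl
sumTo-single {a} (suc n) {φ} a≤1+n vanish with a ≟ suc n
... | yes refl =
  trans (cong (ℤ._+ φ (suc n)) (sumTo-zero n λ i i≤n → vanish i (m≤n⇒m≤1+n i≤n) λ { refl → 1+n≰n i≤n }))
        (ℤₚ.+-identityˡ _)
... | no a≢1+n =
  trans (cong₂ ℤ._+_ (sumTo-single n (≤-pred (≤∧≢⇒< a≤1+n a≢1+n)) λ i i≤n → vanish i (m≤n⇒m≤1+n i≤n))
                     (vanish (suc n) ≤-refl (a≢1+n ∘ sym)))
        (ℤₚ.+-identityʳ _)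

sumTo-minus : ∀ n (φ ψ : ℕ → ℤ) → sumTo n (λ i → φ i ℤ.- ψ i) ≡ sumTo n φ ℤ.- sumTo n ψ
sumTo-minus zero    φ ψ = refl
sumTo-minus (suc n) φ ψ = trans (cong (ℤ._+ (φ (suc n) ℤ.- ψ (suc n))) (sumTo-minus n φ ψ))
                            (interchange (sumTo n φ) (sumTo n ψ) (φ (suc n)) (ψ (suc n)))
  where
  interchange : ∀ a b c d → (a ℤ.- b) ℤ.+ (c ℤ.- d) ≡ (a ℤ.+ c) ℤ.- (b ℤ.+ d)
  interchange = solve-∀

sumTo-antidiagonal-singleˡ : ∀ a n (Φ : ℕ → ℕ → ℤ) → (∀ i m → i ≢ a → Φ i m ≡ 0ℤ) →
                             sumTo n (λ i → Φ i (n ∸ i)) ≡ shiftℤ a (Φ a) n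
sumTo-antidiagonal-singleˡ a n Φ vanish with a ≤? n
... | yes a≤n = trans (sumTo-single n a≤n λ i _ i≢a → vanish i (n ∸ i) i≢a) (sym (shift-≥ a _ a≤n))
... | no a≰n  = trans (sumTo-zero n λ i i≤n → vanish i (n ∸ i) λ { refl → a≰n i≤n })
                      (sym (shift-< a _ (≰⇒> a≰n)))

sumTo-antidiagonal-singleʳ : ∀ b n (Φ : ℕ → ℕ → ℤ) → (∀ i m → m ≢ b → Φ i m ≡ 0ℤ) →
                             sumTo n (λ i → Φ i (n ∸ i)) ≡ shiftℤ b (λ i → Φ i b) n
sumTo-antidiagonal-singleʳ b n Φ vanish with b ≤? n
... | yes b≤n = begin
  sumTo n (λ i → Φ i (n ∸ i))
    ≡⟨ sumTo-single n (m∸n≤m n b) (λ i i≤n i≢ → vanish i (n ∸ i) λ e → i≢ (trans (sym (m∸[m∸n]≡n i≤n)) (cong (n ∸_) e))) ⟩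
  Φ (n ∸ b) (n ∸ (n ∸ b))   ≡⟨ cong (Φ (n ∸ b)) (m∸[m∸n]≡n b≤n) ⟩
  Φ (n ∸ b) b               ≡⟨ shift-≥ b _ b≤n ⟨
  shiftℤ b (λ i → Φ i b) n  ∎
  where open ≡-Reasoning
... | no b≰n = trans (sumTo-zero n λ i _ → vanish i (n ∸ i) λ e → b≰n (subst (_≤ n) e (m∸n≤m n i)))
                     (sym (shift-< b _ (≰⇒> b≰n)))

sumTo-antidiagonal-shift : ∀ a n (Φ : ℕ → ℕ → ℤ) →
  sumTo n (λ i → shiftℤ a (Φ i) (n ∸ i)) ≡ shiftℤ a (λ m → sumTo m (λ i → Φ i (m ∸ i))) n
sumTo-antidiagonal-shift zero    n       Φ = refl
sumTo-antidiagonal-shift (suc a) zero    Φ = refl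
sumTo-antidiagonal-shift (suc a) (suc n) Φ = begin
  sumTo n (λ i → shiftℤ (suc a) (Φ i) (suc n ∸ i)) ℤ.+ shiftℤ (suc a) (Φ (suc n)) (suc n ∸ suc n)
    ≡⟨ cong₂ ℤ._+_ (sumTo-cong n λ i i≤n → cong (shiftℤ (suc a) (Φ i)) (+-∸-assoc 1 i≤n))
                   (cong (shiftℤ (suc a) (Φ (suc n))) (n∸n≡0 n)) ⟩
  sumTo n (λ i → shiftℤ a (Φ i) (n ∸ i)) ℤ.+ 0ℤ
    ≡⟨ ℤₚ.+-identityʳ _ ⟩
  sumTo n (λ i → shiftℤ a (Φ i) (n ∸ i))
    ≡⟨ sumTo-antidiagonal-shift a n Φ ⟩
  shiftℤ a (λ m → sumTo m (λ i → Φ i (m ∸ i))) n ∎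
  where open ≡-Reasoning

sumℕ : ℕ → (ℕ → ℕ) → ℕ
sumℕ zero    φ = φ 0
sumℕ (suc n) φ = sumℕ n φ + φ (suc n)

_⊛_ : (ℕ → ℕ) → (ℕ → ℕ) → ℕ → ℕ
(u ⊛ v) k = sumℕ k (λ t → u t * v (k ∸ t))

sumℕ-cong : ∀ n {φ ψ : ℕ → ℕ} → (∀ i → i ≤ n → φ i ≡ ψ i) → sumℕ n φ ≡ sumℕ n ψ
sumℕ-cong zero    eq = eq 0 z≤n
sumℕ-cong (suc n) eq = cong₂ _+_ (sumℕ-cong n λ i i≤n → eq i (m≤n⇒m≤1+n i≤n)) (eq (suc n) ≤-refl)

sumℕ-distrib-+ : ∀ n (φ ψ : ℕ → ℕ) → sumℕ n (λ i → φ i + ψ i) ≡ sumℕ n φ + sumℕ n ψ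
sumℕ-distrib-+ zero    φ ψ = refl
sumℕ-distrib-+ (suc n) φ ψ =
  trans (cong (_+ (φ (suc n) + ψ (suc n))) (sumℕ-distrib-+ n φ ψ))
        (+-interchange (sumℕ n φ) (sumℕ n ψ) (φ (suc n)) (ψ (suc n)))

sumℕ-*ˡ : ∀ n c (φ : ℕ → ℕ) → c * sumℕ n φ ≡ sumℕ n (λ i → c * φ i)
sumℕ-*ˡ zero    c φ = refl
sumℕ-*ˡ (suc n) c φ = trans (*-distribˡ-+ c (sumℕ n φ) (φ (suc n))) (cong (_+ c * φ (suc n)) (sumℕ-*ˡ n c φ))

sumℕ-*ʳ : ∀ n c (φ : ℕ → ℕ) → sumℕ n φ * c ≡ sumℕ n (λ i → φ i * c)
sumℕ-*ʳ zero    c φ = refl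
sumℕ-*ʳ (suc n) c φ = trans (*-distribʳ-+ c (sumℕ n φ) (φ (suc n))) (cong (_+ φ (suc n) * c) (sumℕ-*ʳ n c φ))

sumℕ-peel : ∀ n (φ : ℕ → ℕ) → sumℕ (suc n) φ ≡ φ 0 + sumℕ n (λ i → φ (suc i))
sumℕ-peel zero    φ = refl
sumℕ-peel (suc n) φ = trans (cong (_+ φ (suc (suc n))) (sumℕ-peel n φ)) (+-assoc (φ 0) _ _)

sumℕ-exchange : ∀ n (G : ℕ → ℕ → ℕ) →
  sumℕ n (λ i → sumℕ (n ∸ i) (G i)) ≡ sumℕ n (λ m → sumℕ m (λ i → G i (m ∸ i)))
sumℕ-exchange zero    G = refl
sumℕ-exchange (suc n) G = begin
  sumℕ n (λ i → sumℕ (suc n ∸ i) (G i)) + sumℕ (suc n ∸ suc n) (G (suc n))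
    ≡⟨ cong₂ _+_ (sumℕ-cong n λ i i≤n → cong (λ t → sumℕ t (G i)) (+-∸-assoc 1 i≤n))
                 (cong (λ t → sumℕ t (G (suc n))) (n∸n≡0 n)) ⟩
  sumℕ n (λ i → sumℕ (n ∸ i) (G i) + G i (suc (n ∸ i))) + G (suc n) 0
    ≡⟨ cong (_+ G (suc n) 0) (sumℕ-distrib-+ n _ _) ⟩
  (sumℕ n (λ i → sumℕ (n ∸ i) (G i)) + sumℕ n (λ i → G i (suc (n ∸ i)))) + G (suc n) 0
    ≡⟨ +-assoc (sumℕ n (λ i → sumℕ (n ∸ i) (G i))) _ _ ⟩
  sumℕ n (λ i → sumℕ (n ∸ i) (G i)) + (sumℕ n (λ i → G i (suc (n ∸ i))) + G (suc n) 0)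
    ≡⟨ cong₂ _+_ (sumℕ-exchange n G)
                 (cong₂ _+_ (sumℕ-cong n λ i i≤n → cong (G i) (sym (+-∸-assoc 1 i≤n)))
                            (cong (G (suc n)) (sym (n∸n≡0 n)))) ⟩
  sumℕ n (λ m → sumℕ m (λ i → G i (m ∸ i))) + sumℕ (suc n) (λ i → G i (suc n ∸ i)) ∎
  where open ≡-Reasoning

⊛-cong : ∀ n {u u′ v v′} → (∀ i → i ≤ n → u i ≡ u′ i) → (∀ i → i ≤ n → v i ≡ v′ i) →
         (u ⊛ v) n ≡ (u′ ⊛ v′) n
⊛-cong n eu ev = sumℕ-cong n λ i i≤n → cong₂ _*_ (eu i i≤n) (ev (n ∸ i) (m∸n≤m n i))

⊛-distribʳ-+ : ∀ u u′ v k → ((λ i → u i + u′ i) ⊛ v) k ≡ (u ⊛ v) k + (u′ ⊛ v) k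
⊛-distribʳ-+ u u′ v k = trans (sumℕ-cong k λ t _ → *-distribʳ-+ (v (k ∸ t)) (u t) (u′ t)) (sumℕ-distrib-+ k _ _)

⊛-assoc : ∀ u v w n → (u ⊛ (v ⊛ w)) n ≡ ((u ⊛ v) ⊛ w) n
⊛-assoc u v w n = begin
  sumℕ n (λ i → u i * sumℕ (n ∸ i) (λ j → v j * w (n ∸ i ∸ j)))
    ≡⟨ sumℕ-cong n (λ i _ → sumℕ-*ˡ (n ∸ i) (u i) _) ⟩
  sumℕ n (λ i → sumℕ (n ∸ i) (λ j → u i * (v j * w (n ∸ i ∸ j))))
    ≡⟨ sumℕ-exchange n (λ i j → u i * (v j * w (n ∸ i ∸ j))) ⟩
  sumℕ n (λ m → sumℕ m (λ i → u i * (v (m ∸ i) * w (n ∸ i ∸ (m ∸ i)))))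
    ≡⟨ sumℕ-cong n (λ m m≤n → sumℕ-cong m λ i i≤m →
         trans (cong (λ t → u i * (v (m ∸ i) * w t)) (trans (∸-+-assoc n i (m ∸ i)) (cong (n ∸_) (m+[n∸m]≡n i≤m))))
               (sym (*-assoc (u i) _ _))) ⟩
  sumℕ n (λ m → sumℕ m (λ i → u i * v (m ∸ i) * w (n ∸ m)))
    ≡⟨ sumℕ-cong n (λ m _ → sym (sumℕ-*ʳ m (w (n ∸ m)) _)) ⟩
  sumℕ n (λ m → sumℕ m (λ i → u i * v (m ∸ i)) * w (n ∸ m)) ∎
  where open ≡-Reasoning

⊛-shiftʳ : ∀ u v n → (u ⊛ shiftℕ 1 v) n ≡ shiftℕ 1 (u ⊛ v) n
⊛-shiftʳ u v zero    = *-zeroʳ (u 0)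
⊛-shiftʳ u v (suc n) = begin
  sumℕ n (λ i → u i * shiftℕ 1 v (suc n ∸ i)) + u (suc n) * shiftℕ 1 v (suc n ∸ suc n)
    ≡⟨ cong₂ _+_ (sumℕ-cong n λ i i≤n → cong (λ t → u i * shiftℕ 1 v t) (+-∸-assoc 1 i≤n))
                 (trans (cong (λ t → u (suc n) * shiftℕ 1 v t) (n∸n≡0 n)) (*-zeroʳ (u (suc n)))) ⟩
  (u ⊛ v) n + 0
    ≡⟨ +-identityʳ _ ⟩
  (u ⊛ v) n ∎
  where open ≡-Reasoning

⊛-shiftˡ : ∀ u v n → (shiftℕ 1 u ⊛ v) n ≡ shiftℕ 1 (u ⊛ v) n
⊛-shiftˡ u v zero    = refl
⊛-shiftˡ u v (suc n) = sumℕ-peel n _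

sumℕ-zero : ∀ n → sumℕ n (λ _ → 0) ≡ 0
sumℕ-zero zero    = refl
sumℕ-zero (suc n) = trans (+-identityʳ _) (sumℕ-zero n)

δ-⊛ : ∀ b g k → (δ b ⊛ g) k ≡ shiftℕ b g k
δ-⊛ zero    g zero    = +-identityʳ (g 0)
δ-⊛ (suc b) g zero    = refl
δ-⊛ zero    g (suc k) = trans (sumℕ-peel k _) (trans (cong₂ _+_ (+-identityʳ (g (suc k))) (sumℕ-zero k)) (+-identityʳ _))
δ-⊛ (suc b) g (suc k) = trans (sumℕ-peel k _) (δ-⊛ b g k)

shiftˣ : ℕ → Series → Series
shiftˣ a f n k = shiftℤ a (λ m → f m k) n

shiftʷ : ℕ → Series → Series
shiftʷ b f n k = shiftℤ b (f n) k

*ˢ-congʳ : ∀ f {g h} → g ≈ˢ h → (f *ˢ g) ≈ˢ (f *ˢ h)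
*ˢ-congʳ f g≈h n k = sumTo-cong n λ i _ → sumTo-cong k λ j _ → cong (f i j ℤ.*_) (g≈h (n ∸ i) (k ∸ j))

*ˢ-congˡ : ∀ {f g} h → f ≈ˢ g → (f *ˢ h) ≈ˢ (g *ˢ h)
*ˢ-congˡ h f≈g n k = sumTo-cong n λ i _ → sumTo-cong k λ j _ → cong (ℤ._* h (n ∸ i) (k ∸ j)) (f≈g i j)

*ˢ-distribˡ--ˢ : ∀ f g h → (f *ˢ (g -ˢ h)) ≈ˢ ((f *ˢ g) -ˢ (f *ˢ h))
*ˢ-distribˡ--ˢ f g h n k =
  trans (sumTo-cong n λ i _ → trans (sumTo-cong k λ j _ → distrib (f i j) _ _) (sumTo-minus k _ _))
        (sumTo-minus n _ _)
  where
  distrib : ∀ x y z → x ℤ.* (y ℤ.- z) ≡ x ℤ.* y ℤ.- x ℤ.* z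
  distrib = solve-∀

mono-≢ˣ : ∀ c a b {n} k → n ≢ a → mono c a b n k ≡ 0ℤ
mono-≢ˣ c a b {n} k n≢a = cong (λ t → if t ∧ does (k ≟ b) then c else 0ℤ) (dec-false (n ≟ a) n≢a)

mono-≢ʷ : ∀ c a b n {k} → k ≢ b → mono c a b n k ≡ 0ℤ
mono-≢ʷ c a b n {k} k≢b =
  cong (λ t → if t then c else 0ℤ) (trans (cong (does (n ≟ a) ∧_) (dec-false (k ≟ b) k≢b)) (∧-zeroʳ _))

mono-≡ : ∀ c a b → mono c a b a b ≡ c
mono-≡ c a b = cong₂ (λ s t → if s ∧ t then c else 0ℤ) (dec-true (a ≟ a) refl) (dec-true (b ≟ b) refl)

*ˢ-mono : ∀ f c a b → (f *ˢ mono c a b) ≈ˢ shiftˣ a (shiftʷ b (λ n k → f n k ℤ.* c))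
*ˢ-mono f c a b n k =
  trans (sumTo-antidiagonal-singleʳ a n _ λ i m m≢a → sumTo-zero k λ j _ →
           trans (cong (f i j ℤ.*_) (mono-≢ˣ c a b (k ∸ j) m≢a)) (ℤₚ.*-zeroʳ (f i j)))
        (shift-cong a (λ i →
           trans (sumTo-antidiagonal-singleʳ b k _ λ j m m≢b →
                    trans (cong (f i j ℤ.*_) (mono-≢ʷ c a b a m≢b)) (ℤₚ.*-zeroʳ (f i j)))
                 (shift-cong b (λ j → cong (f i j ℤ.*_) (mono-≡ c a b)) k)) n)

mono-*ˢ : ∀ c a b g → (mono c a b *ˢ g) ≈ˢ shiftˣ a (shiftʷ b (λ n k → c ℤ.* g n k))
mono-*ˢ c a b g n k =
  trans (sumTo-antidiagonal-singleˡ a n _ λ i m i≢a → sumTo-zero k λ j _ →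
           cong (ℤ._* g m (k ∸ j)) (mono-≢ˣ c a b j i≢a))
        (shift-cong a (λ m →
           trans (sumTo-antidiagonal-singleˡ b k _ λ j m′ j≢b → cong (ℤ._* g m m′) (mono-≢ʷ c a b a j≢b))
                 (shift-cong b (λ k′ → cong (ℤ._* g m k′) (mono-≡ c a b)) k)) n)

*ˢ-shiftˣ : ∀ f a g → (f *ˢ shiftˣ a g) ≈ˢ shiftˣ a (f *ˢ g)
*ˢ-shiftˣ f a g n k =
  trans (sumTo-cong n λ i _ →
           shift-commute (λ v → sumTo k λ j → f i j ℤ.* v j)
                         (sumTo-zero k λ j _ → ℤₚ.*-zeroʳ (f i j)) a (λ j m → g m (k ∸ j)) (n ∸ i))
        (sumTo-antidiagonal-shift a n λ i m → sumTo k λ j → f i j ℤ.* g m (k ∸ j))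

w-1·_ : Series → Series
(w-1· f) n k = shiftʷ 1 f n k ℤ.- f n k

*ˢ-oneˢ : ∀ f → (f *ˢ oneˢ) ≈ˢ f
*ˢ-oneˢ f n k = trans (*ˢ-mono f (+ 1) 0 0 n k) (ℤₚ.*-identityʳ (f n k))

*ˢ-X : ∀ f → (f *ˢ X) ≈ˢ shiftˣ 1 f
*ˢ-X f n k = trans (*ˢ-mono f (+ 1) 1 0 n k) (shift-cong 1 (λ m → ℤₚ.*-identityʳ (f m k)) n)

W*ˢX : (W *ˢ X) ≈ˢ mono (+ 1) 1 1
W*ˢX n k = trans (mono-*ˢ (+ 1) 0 1 X n k) (coefficient n k)
  where
  coefficient : ∀ n k → shiftℤ 1 (λ k′ → + 1 ℤ.* X n k′) k ≡ mono (+ 1) 1 1 n k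
  coefficient zero          zero    = refl
  coefficient (suc zero)    zero    = refl
  coefficient (suc (suc n)) zero    = refl
  coefficient n             (suc k) = ℤₚ.*-identityˡ _

*ˢ-W*ˢX : ∀ f → (f *ˢ (W *ˢ X)) ≈ˢ shiftˣ 1 (shiftʷ 1 f)
*ˢ-W*ˢX f n k = trans (*ˢ-congʳ f W*ˢX n k)
  (trans (*ˢ-mono f (+ 1) 1 1 n k) (shift-cong 1 (λ m → shift-cong 1 (λ k′ → ℤₚ.*-identityʳ (f m k′)) k) n))

*ˢ-mono-*ˢ : ∀ f c a g → (f *ˢ (mono c a 0 *ˢ g)) ≈ˢ shiftˣ a (f *ˢ (λ n k → c ℤ.* g n k))
*ˢ-mono-*ˢ f c a g n k = trans (*ˢ-congʳ f (mono-*ˢ c a 0 g) n k) (*ˢ-shiftˣ f a (λ n k → c ℤ.* g n k) n k)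

*ˢ-x² : ∀ f T → (f *ˢ (mono (+ 1) 2 0 *ˢ T)) ≈ˢ shiftˣ 2 (f *ˢ T)
*ˢ-x² f T n k =
  trans (*ˢ-mono-*ˢ f (+ 1) 2 T n k) (shift-cong 2 (λ m → *ˢ-congʳ f (λ n k → ℤₚ.*-identityˡ (T n k)) m k) n)

*ˢ-[w-1] : ∀ f c → (f *ˢ (λ n k → c ℤ.* (W -ˢ oneˢ) n k)) ≈ˢ (w-1· (λ n k → f n k ℤ.* c))
*ˢ-[w-1] f c n k = begin
  (f *ˢ (λ n k → c ℤ.* (W -ˢ oneˢ) n k)) n k
    ≡⟨ *ˢ-congʳ f (λ n k → trans (distrib c _ _) (cong₂ ℤ._-_ (scale c (does (n ≟ 0) ∧ does (k ≟ 1)))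
                                                              (scale c (does (n ≟ 0) ∧ does (k ≟ 0))))) n k ⟩
  (f *ˢ (mono c 0 1 -ˢ mono c 0 0)) n k
    ≡⟨ *ˢ-distribˡ--ˢ f (mono c 0 1) (mono c 0 0) n k ⟩
  (f *ˢ mono c 0 1) n k ℤ.- (f *ˢ mono c 0 0) n k
    ≡⟨ cong₂ ℤ._-_ (*ˢ-mono f c 0 1 n k) (*ˢ-mono f c 0 0 n k) ⟩
  (w-1· (λ n k → f n k ℤ.* c)) n k ∎
  where
  open ≡-Reasoning
  distrib : ∀ x y z → x ℤ.* (y ℤ.- z) ≡ x ℤ.* y ℤ.- x ℤ.* z
  distrib = solve-∀
  scale : ∀ c t → c ℤ.* (if t then + 1 else 0ℤ) ≡ (if t then c else 0ℤ)
  scale c true  = ℤₚ.*-identityʳ c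
  scale c false = ℤₚ.*-zeroʳ c

*ˢ-level₀ : ∀ f T → (f *ˢ level₀ T) ≈ˢ ((f -ˢ shiftˣ 1 (shiftʷ 1 f)) -ˢ shiftˣ 2 (f *ˢ T))
*ˢ-level₀ f T n k =
  trans (*ˢ-distribˡ--ˢ f (oneˢ -ˢ (W *ˢ X)) (mono (+ 1) 2 0 *ˢ T) n k)
        (cong₂ ℤ._-_ (trans (*ˢ-distribˡ--ˢ f oneˢ (W *ˢ X) n k) (cong₂ ℤ._-_ (*ˢ-oneˢ f n k) (*ˢ-W*ˢX f n k)))
                     (*ˢ-x² f T n k))

*ˢ-levelₛ : ∀ f j T → (f *ˢ levelₛ j T) ≈ˢ
  (((f -ˢ shiftˣ 1 f) -ˢ shiftˣ (j + 2) (w-1· (λ n k → f n k ℤ.* + Motzkin j))) -ˢ shiftˣ 2 (f *ˢ T))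
*ˢ-levelₛ f j T n k =
  trans (*ˢ-distribˡ--ˢ f ((oneˢ -ˢ X) -ˢ (mono c (j + 2) 0 *ˢ (W -ˢ oneˢ))) (mono (+ 1) 2 0 *ˢ T) n k)
        (cong₂ ℤ._-_ (trans (*ˢ-distribˡ--ˢ f (oneˢ -ˢ X) (mono c (j + 2) 0 *ˢ (W -ˢ oneˢ)) n k)
                            (cong₂ ℤ._-_ (trans (*ˢ-distribˡ--ˢ f oneˢ X n k) (cong₂ ℤ._-_ (*ˢ-oneˢ f n k) (*ˢ-X f n k)))
                                         (trans (*ˢ-mono-*ˢ f c (j + 2) (W -ˢ oneˢ) n k)
                                                (shift-cong (j + 2) (λ m → *ˢ-[w-1] f c m k) n))))
                     (*ˢ-x² f T n k))
  where
  c : ℤ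
  c = + Motzkin j

+-sumℕ : ∀ n φ → + sumℕ n φ ≡ sumTo n (λ i → + φ i)
+-sumℕ zero    φ = refl
+-sumℕ (suc n) φ = trans (ℤₚ.pos-+ (sumℕ n φ) (φ (suc n))) (cong (ℤ._+ + φ (suc n)) (+-sumℕ n φ))

fromℕ²-*ˢ : ∀ F G n k → (fromℕ² F *ˢ fromℕ² G) n k ≡ + sumℕ n (λ i → (F i ⊛ G (n ∸ i)) k)
fromℕ²-*ˢ F G n k = sym (trans (+-sumℕ n _) (sumTo-cong n λ i _ →
  trans (+-sumℕ k _) (sumTo-cong k λ j _ → ℤₚ.pos-* (F i j) (G (n ∸ i) (k ∸ j)))))

+-⊛-δ₀ : ∀ u {v} M → (∀ k → v k ≡ δ 0 k * M) → ∀ k → + (u ⊛ v) k ≡ + u k ℤ.* + M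
+-⊛-δ₀ u {v} M v≡ k = begin
  + (u ⊛ v) k
    ≡⟨ +-sumℕ k _ ⟩
  sumTo k (λ t → + (u t * v (k ∸ t)))
    ≡⟨ sumTo-cong k (λ t _ → trans (cong (λ x → + (u t * x)) (v≡ (k ∸ t))) (ℤₚ.pos-* (u t) _)) ⟩
  sumTo k (λ t → + u t ℤ.* + (δ 0 (k ∸ t) * M))
    ≡⟨ sumTo-antidiagonal-singleʳ 0 k (λ t m → + u t ℤ.* + (δ 0 m * M))
         (λ t m m≢0 → trans (cong (λ x → + u t ℤ.* + (x * M)) (δ-≢ (m≢0 ∘ sym))) (ℤₚ.*-zeroʳ (+ u t))) ⟩
  + u k ℤ.* + (1 * M)
    ≡⟨ cong (λ x → + u k ℤ.* + x) (*-identityˡ M) ⟩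
  + u k ℤ.* + M ∎
  where open ≡-Reasoning

sumℕ-tilt-antidiagonal : ∀ j N k (u v : ℕ → ℕ → ℕ) →
  + sumℕ N (λ i → shiftℕ (δ (N ∸ i) j) (u i ⊛ v (N ∸ i)) k)
  ≡ + sumℕ N (λ i → (u i ⊛ v (N ∸ i)) k) ℤ.+ shiftℤ j (λ i → + shiftℕ 1 (u i ⊛ v j) k ℤ.- + (u i ⊛ v j) k) N
sumℕ-tilt-antidiagonal j N k u v =
  trans (split (+ sumℕ N tilted) (+ sumℕ N untilted)) (cong (ℤ._+_ (+ sumℕ N untilted)) correction)
  where
  tilted untilted : ℕ → ℕ
  tilted   i = shiftℕ (δ (N ∸ i) j) (u i ⊛ v (N ∸ i)) k
  untilted i = (u i ⊛ v (N ∸ i)) k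
  split : ∀ a b → a ≡ b ℤ.+ (a ℤ.- b)
  split = solve-∀
  Φ : ℕ → ℕ → ℤ
  Φ i m = + shiftℕ (δ m j) (u i ⊛ v m) k ℤ.- + (u i ⊛ v m) k
  correction : + sumℕ N tilted ℤ.- + sumℕ N untilted ≡ shiftℤ j (λ i → + shiftℕ 1 (u i ⊛ v j) k ℤ.- + (u i ⊛ v j) k) N
  correction = begin
    + sumℕ N tilted ℤ.- + sumℕ N untilted
      ≡⟨ cong₂ ℤ._-_ (+-sumℕ N tilted) (+-sumℕ N untilted) ⟩
    sumTo N (λ i → + tilted i) ℤ.- sumTo N (λ i → + untilted i)
      ≡⟨ sumTo-minus N _ _ ⟨
    sumTo N (λ i → Φ i (N ∸ i))
      ≡⟨ sumTo-antidiagonal-singleʳ j N Φ (λ i m m≢j →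
           trans (cong (λ t → + shiftℕ t (u i ⊛ v m) k ℤ.- + (u i ⊛ v m) k) (δ-≢ m≢j))
                 (ℤₚ.+-inverseʳ (+ (u i ⊛ v m) k))) ⟩
    shiftℤ j (λ i → Φ i j) N
      ≡⟨ shift-cong j (λ i → cong (λ t → + shiftℕ t (u i ⊛ v j) k ℤ.- + (u i ⊛ v j) k) (δ-refl j)) N ⟩
    shiftℤ j (λ i → + shiftℕ 1 (u i ⊛ v j) k ℤ.- + (u i ⊛ v j) k) N ∎
    where open ≡-Reasoning

-- The continued fraction from the recurrence of its tails

module ContinuedFraction
  (F : ℕ → ℕ → ℕ → ℕ)
  (F-zero : ∀ d k → F d 0 k ≡ δ 0 k)
  (F-suc : ∀ d n k → F d (suc n) k ≡
     shiftℕ (δ 0 d) (F d n) k +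
     shiftℕ 1 (λ N → sumℕ N (λ i → shiftℕ (δ (suc (N ∸ i)) d) (F d i ⊛ F (suc d) (N ∸ i)) k)) n)
  (F-Motzkin : ∀ j k → F (suc (suc j)) j k ≡ δ 0 k * Motzkin j)
  where

  Fˢ : ℕ → Series
  Fˢ d = fromℕ² (F d)

  -- Coefficients of F_d · F̃_{d+1}, where F̃_{d+1} is F_{d+1} with its x^{d-1} coefficient multiplied by w.
  tiltedProduct : ℕ → ℕ → ℕ → ℕ
  tiltedProduct d N k = sumℕ N (λ i → shiftℕ (δ (suc (N ∸ i)) d) (F d i ⊛ F (suc d) (N ∸ i)) k)

  Fˢ-recurrence : ∀ d → Fˢ d ≈ˢ ((oneˢ +ˢ shiftˣ 1 (shiftʷ (δ 0 d) (Fˢ d))) +ˢ shiftˣ 2 (fromℕ² (tiltedProduct d)))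
  Fˢ-recurrence d zero    zero    = cong +_ (F-zero d 0)
  Fˢ-recurrence d zero    (suc k) = cong +_ (F-zero d (suc k))
  Fˢ-recurrence d (suc n) k = begin
    + F d (suc n) k
      ≡⟨ cong +_ (F-suc d n k) ⟩
    + (shiftℕ (δ 0 d) (F d n) k + shiftℕ 1 (λ N → tiltedProduct d N k) n)
      ≡⟨ ℤₚ.pos-+ (shiftℕ (δ 0 d) (F d n) k) _ ⟩
    + shiftℕ (δ 0 d) (F d n) k ℤ.+ + shiftℕ 1 (λ N → tiltedProduct d N k) n
      ≡⟨ cong₂ ℤ._+_ (trans (+-shiftℕ (δ 0 d) (F d n) k) (sym (ℤₚ.+-identityˡ _))) (+-shiftℕ 1 _ n) ⟩
    (0ℤ ℤ.+ shiftʷ (δ 0 d) (Fˢ d) n k) ℤ.+ shiftℤ 1 (λ N → + tiltedProduct d N k) n ∎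
    where open ≡-Reasoning

  level₀-inverse : (Fˢ 0 *ˢ level₀ (Fˢ 1)) ≈ˢ oneˢ
  level₀-inverse n k = begin
    (f *ˢ level₀ (Fˢ 1)) n k
      ≡⟨ *ˢ-level₀ f (Fˢ 1) n k ⟩
    (f n k ℤ.- xwf) ℤ.- xxfg
      ≡⟨ cong (λ t → (t ℤ.- xwf) ℤ.- xxfg) (Fˢ-recurrence 0 n k) ⟩
    (((oneˢ n k ℤ.+ xwf) ℤ.+ shiftˣ 2 (fromℕ² (tiltedProduct 0)) n k) ℤ.- xwf) ℤ.- xxfg
      ≡⟨ cong (λ t → (((oneˢ n k ℤ.+ xwf) ℤ.+ t) ℤ.- xwf) ℤ.- xxfg)
              (shift-cong 2 (λ m → sym (fromℕ²-*ˢ (F 0) (F 1) m k)) n) ⟩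
    (((oneˢ n k ℤ.+ xwf) ℤ.+ xxfg) ℤ.- xwf) ℤ.- xxfg
      ≡⟨ cancel (oneˢ n k) xwf xxfg ⟩
    oneˢ n k ∎
    where
    open ≡-Reasoning
    f : Series
    f = Fˢ 0
    xwf xxfg : ℤ
    xwf = shiftˣ 1 (shiftʷ 1 f) n k
    xxfg = shiftˣ 2 (f *ˢ Fˢ 1) n k
    cancel : ∀ o a b → (((o ℤ.+ a) ℤ.+ b) ℤ.- a) ℤ.- b ≡ o
    cancel = solve-∀

  levelₛ-inverse : ∀ j → (Fˢ (suc j) *ˢ levelₛ j (Fˢ (suc (suc j)))) ≈ˢ oneˢ
  levelₛ-inverse j n k = begin
    (f *ˢ levelₛ j g) n k
      ≡⟨ *ˢ-levelₛ f j g n k ⟩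
    ((f n k ℤ.- xf) ℤ.- shiftˣ (j + 2) e n k) ℤ.- xxfg
      ≡⟨ cong (λ t → ((t ℤ.- xf) ℤ.- shiftˣ (j + 2) e n k) ℤ.- xxfg) (Fˢ-recurrence (suc j) n k) ⟩
    ((((oneˢ n k ℤ.+ xf) ℤ.+ shiftˣ 2 (fromℕ² (tiltedProduct (suc j))) n k) ℤ.- xf) ℤ.- shiftˣ (j + 2) e n k) ℤ.- xxfg
      ≡⟨ cong (λ t → ((((oneˢ n k ℤ.+ xf) ℤ.+ t) ℤ.- xf) ℤ.- shiftˣ (j + 2) e n k) ℤ.- xxfg) x²-tiltedProduct ⟩
    ((((oneˢ n k ℤ.+ xf) ℤ.+ (xxfg ℤ.+ shiftˣ (j + 2) e n k)) ℤ.- xf) ℤ.- shiftˣ (j + 2) e n k) ℤ.- xxfg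
      ≡⟨ cancel (oneˢ n k) xf xxfg (shiftˣ (j + 2) e n k) ⟩
    oneˢ n k ∎
    where
    open ≡-Reasoning
    f g e : Series
    f = Fˢ (suc j)
    g = Fˢ (suc (suc j))
    e = w-1· (λ n k → f n k ℤ.* + Motzkin j)
    xf xxfg : ℤ
    xf = shiftˣ 1 f n k
    xxfg = shiftˣ 2 (f *ˢ g) n k
    cancel : ∀ o a b c → ((((o ℤ.+ a) ℤ.+ (b ℤ.+ c)) ℤ.- a) ℤ.- c) ℤ.- b ≡ o
    cancel = solve-∀
    tiltedProduct-split : ∀ N k → + tiltedProduct (suc j) N k ≡ (f *ˢ g) N k ℤ.+ shiftˣ j e N k
    tiltedProduct-split N k = trans (sumℕ-tilt-antidiagonal j N k (F (suc j)) (F (suc (suc j))))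
      (cong₂ ℤ._+_ (sym (fromℕ²-*ˢ (F (suc j)) (F (suc (suc j))) N k))
                   (shift-cong j (λ i → cong₂ ℤ._-_
                       (trans (+-shiftℕ 1 _ k) (shift-cong 1 (+-⊛-δ₀ (F (suc j) i) (Motzkin j) (F-Motzkin j)) k))
                       (+-⊛-δ₀ (F (suc j) i) (Motzkin j) (F-Motzkin j) k)) N))
    x²-tiltedProduct : shiftˣ 2 (fromℕ² (tiltedProduct (suc j))) n k ≡ xxfg ℤ.+ shiftˣ (j + 2) e n k
    x²-tiltedProduct = begin
      shiftˣ 2 (fromℕ² (tiltedProduct (suc j))) n k
        ≡⟨ shift-cong 2 (λ N → tiltedProduct-split N k) n ⟩
      shiftℤ 2 (λ N → (f *ˢ g) N k ℤ.+ shiftˣ j e N k) n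
        ≡⟨ shift-zipWith ℤ._+_ refl 2 _ _ n ⟨
      xxfg ℤ.+ shiftℤ 2 (λ N → shiftˣ j e N k) n
        ≡⟨ cong (ℤ._+_ xxfg) (trans (shift-shift 2 j _ n) (cong (λ a → shiftˣ a e n k) (+-comm 2 j))) ⟩
      xxfg ℤ.+ shiftˣ (j + 2) e n k ∎

-- Motzkin numbers

paths-first-descent : ∀ m h → paths (suc m) (suc h) ≡ (Motzkin ⊛ (λ i → paths i h)) m
paths-first-descent m = below m m ≤-refl
  where
  P : ℕ → ℕ → ℕ
  P h i = paths i h
  below : ∀ n m → m ≤ n → ∀ h → paths (suc m) (suc h) ≡ (Motzkin ⊛ P h) m
  below n zero    _ h = sym (*-identityˡ (paths 0 h))
  below (suc n) (suc m) (s≤s m≤n) h = begin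
    paths (suc m) (suc (suc h)) + paths (suc m) (suc h) + paths (suc m) h
      ≡⟨ cong₂ (λ a b → a + b + paths (suc m) h) (below n m m≤n (suc h)) (below n m m≤n h) ⟩
    (Motzkin ⊛ P (suc h)) m + (Motzkin ⊛ P h) m + paths (suc m) h
      ≡⟨ cong (λ t → t + (Motzkin ⊛ P h) m + paths (suc m) h) one-step-higher ⟩
    (P 1 ⊛ P h) m + (Motzkin ⊛ P h) m + paths (suc m) h
      ≡⟨ cong (_+ paths (suc m) h) (⊛-distribʳ-+ (P 1) Motzkin (P h) m) ⟨
    ((λ i → Motzkin (suc i)) ⊛ P h) m + paths (suc m) h
      ≡⟨ +-comm _ (paths (suc m) h) ⟩
    paths (suc m) h + ((λ i → Motzkin (suc i)) ⊛ P h) m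
      ≡⟨ cong (_+ ((λ i → Motzkin (suc i)) ⊛ P h) m) (sym (*-identityˡ (paths (suc m) h))) ⟩
    Motzkin 0 * P h (suc m) + sumℕ m (λ i → Motzkin (suc i) * P h (suc m ∸ suc i))
      ≡⟨ sumℕ-peel m (λ i → Motzkin i * P h (suc m ∸ i)) ⟨
    (Motzkin ⊛ P h) (suc m) ∎
    where
    open ≡-Reasoning
    P-suc : ∀ h′ i → i ≤ m → P (suc h′) i ≡ shiftℕ 1 (Motzkin ⊛ P h′) i
    P-suc h′ zero    _   = refl
    P-suc h′ (suc i) i<m = below n i (≤-trans (≤-trans (n≤1+n i) i<m) m≤n) h′
    one-step-higher : (Motzkin ⊛ P (suc h)) m ≡ (P 1 ⊛ P h) m
    one-step-higher = begin
      (Motzkin ⊛ P (suc h)) m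
        ≡⟨ ⊛-cong m {Motzkin} {Motzkin} (λ _ _ → refl) (P-suc h) ⟩
      (Motzkin ⊛ shiftℕ 1 (Motzkin ⊛ P h)) m
        ≡⟨ ⊛-shiftʳ Motzkin (Motzkin ⊛ P h) m ⟩
      shiftℕ 1 (Motzkin ⊛ (Motzkin ⊛ P h)) m
        ≡⟨ shift-cong 1 (⊛-assoc Motzkin Motzkin (P h)) m ⟩
      shiftℕ 1 ((Motzkin ⊛ Motzkin) ⊛ P h) m
        ≡⟨ ⊛-shiftˡ (Motzkin ⊛ Motzkin) (P h) m ⟨
      (shiftℕ 1 (Motzkin ⊛ Motzkin) ⊛ P h) m
        ≡⟨ ⊛-cong m {v = P h} {P h} (λ i i≤m → sym (P-suc 0 i i≤m)) (λ _ _ → refl) ⟩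
      (P 1 ⊛ P h) m ∎

Motzkin-rec : ∀ N → Motzkin (suc (suc N)) ≡ Motzkin (suc N) + (Motzkin ⊛ Motzkin) N
Motzkin-rec N = trans (cong (_+ Motzkin (suc N)) (paths-first-descent N 0)) (+-comm _ (Motzkin (suc N)))

Motzkin-unique : (L : ℕ → ℕ) → L 0 ≡ 1 → L 1 ≡ 1 → (∀ N → L (suc (suc N)) ≡ L (suc N) + (L ⊛ L) N) →
                 ∀ n → L n ≡ Motzkin n
Motzkin-unique L L0 L1 L-rec n = below n n ≤-refl
  where
  below : ∀ n m → m ≤ n → L m ≡ Motzkin m
  below n       zero          _         = L0
  below n       (suc zero)    _         = L1
  below (suc n) (suc (suc m)) (s≤s m<n) = begin
    L (suc (suc m))                ≡⟨ L-rec m ⟩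
    L (suc m) + (L ⊛ L) m          ≡⟨ cong₂ _+_ (below n (suc m) m<n) (⊛-cong m IH IH) ⟩
    Motzkin (suc m) + (Motzkin ⊛ Motzkin) m  ≡⟨ Motzkin-rec m ⟨
    Motzkin (suc (suc m))          ∎
    where
    open ≡-Reasoning
    IH : ∀ i → i ≤ m → L i ≡ Motzkin i
    IH i i≤m = below n i (≤-trans i≤m (≤-trans (n≤1+n m) m<n))

-- Pattern containment and the decomposition of 𝔐ᴿ

data AnyPair (R : ℕ → ℕ → Set) : List ℕ → Set where
  here  : ∀ {y ys} → Any (R y) ys → AnyPair R (y ∷ ys)
  there : ∀ {y ys} → AnyPair R ys → AnyPair R (y ∷ ys)

data Has231 : List ℕ → Set where
  here  : ∀ {x xs} → AnyPair (λ y z → z < x × x < y) xs → Has231 (x ∷ xs)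
  there : ∀ {x xs} → Has231 xs → Has231 (x ∷ xs)

data Has32-1 : List ℕ → Set where
  here  : ∀ {x y zs} → y < x → Any (_< y) zs → Has32-1 (x ∷ y ∷ zs)
  there : ∀ {x xs} → Has32-1 xs → Has32-1 (x ∷ xs)

record Avoids (π : List ℕ) : Set where
  constructor avoids
  field
    no231  : ¬ Has231 π
    no32-1 : ¬ Has32-1 π

open Avoids

module _ {R : ℕ → ℕ → Set} where

  AnyPair-lookup : ∀ xs (j k : Fin (length xs)) → j <ᶠ k → R (lookup xs j) (lookup xs k) → AnyPair R xs
  AnyPair-lookup (y ∷ ys) Fin.zero    (Fin.suc k) _         r = here (lose (∈-lookup k) r)
  AnyPair-lookup (y ∷ ys) (Fin.suc j) (Fin.suc k) (s≤s j<k) r = there (AnyPair-lookup ys j k j<k r)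

  AnyPair-index : ∀ {xs} → AnyPair R xs →
                  Σ[ j ∈ Fin (length xs) ] Σ[ k ∈ Fin (length xs) ] (j <ᶠ k × R (lookup xs j) (lookup xs k))
  AnyPair-index (here p)  = Fin.zero , Fin.suc (Any.index p) , s≤s z≤n , Anyₚ.lookup-index p
  AnyPair-index (there s) with AnyPair-index s
  ... | j , k , j<k , r = Fin.suc j , Fin.suc k , s≤s j<k , r

  AnyPair-++⁺ˡ : ∀ {xs} ys → AnyPair R xs → AnyPair R (xs ++ ys)
  AnyPair-++⁺ˡ ys (here p)  = here (Anyₚ.++⁺ˡ p)
  AnyPair-++⁺ˡ ys (there s) = there (AnyPair-++⁺ˡ ys s)

  AnyPair-++⁺ʳ : ∀ xs {ys} → AnyPair R ys → AnyPair R (xs ++ ys)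
  AnyPair-++⁺ʳ []       s = s
  AnyPair-++⁺ʳ (x ∷ xs) s = there (AnyPair-++⁺ʳ xs s)

  AnyPair-first : ∀ {xs} → AnyPair R xs → Any (λ y → ∃[ z ] R y z) xs
  AnyPair-first (here p)  = here (Any.satisfied p)
  AnyPair-first (there s) = there (AnyPair-first s)

  AnyPair-second : ∀ {xs} → AnyPair R xs → Any (λ z → ∃[ y ] R y z) xs
  AnyPair-second (here {y} p) = there (Any.map (y ,_) p)
  AnyPair-second (there s)    = there (AnyPair-second s)

  AnyPair-++⁻ : ∀ xs {ys} → AnyPair R (xs ++ ys) → AnyPair R xs ⊎ Any (λ z → ∃[ y ] R y z) ys
  AnyPair-++⁻ []       s         = inj₂ (AnyPair-second s)
  AnyPair-++⁻ (x ∷ xs) (here p) with Anyₚ.++⁻ xs p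
  ... | inj₁ q = inj₁ (here q)
  ... | inj₂ q = inj₂ (Any.map (x ,_) q)
  AnyPair-++⁻ (x ∷ xs) (there s) with AnyPair-++⁻ xs s
  ... | inj₁ s′ = inj₁ (there s′)
  ... | inj₂ q  = inj₂ q

All⇒¬Any : ∀ {P Q : ℕ → Set} {xs} → (∀ {x} → P x → Q x → ⊥) → All P xs → ¬ Any Q xs
All⇒¬Any P⇒¬Q = All.lookupWith P⇒¬Q

Contains231⇒Has231 : ∀ π → Contains231 π → Has231 π
Contains231⇒Has231 (x ∷ xs) (Fin.zero  , Fin.suc j , Fin.suc k , _       , s≤s j<k , r) = here (AnyPair-lookup xs j k j<k r)
Contains231⇒Has231 (x ∷ xs) (Fin.suc i , Fin.suc j , Fin.suc k , s≤s i<j , s≤s j<k , r) =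
  there (Contains231⇒Has231 xs (i , j , k , i<j , j<k , r))

Has231⇒Contains231 : ∀ {π} → Has231 π → Contains231 π
Has231⇒Contains231 (here s) with AnyPair-index s
... | j , k , j<k , r = Fin.zero , Fin.suc j , Fin.suc k , s≤s z≤n , s≤s j<k , r
Has231⇒Contains231 (there c) with Has231⇒Contains231 c
... | i , j , k , i<j , j<k , r = Fin.suc i , Fin.suc j , Fin.suc k , s≤s i<j , s≤s j<k , r

Contains32-1⇒Has32-1 : ∀ π → Contains32-1 π → Has32-1 π
Contains32-1⇒Has32-1 (x ∷ y ∷ zs) (Fin.zero , Fin.suc Fin.zero , Fin.suc (Fin.suc b) , refl , _ , y<x , z<y) =
  here y<x (lose (∈-lookup b) z<y)
Contains32-1⇒Has32-1 (x ∷ y ∷ zs) (Fin.zero , Fin.suc Fin.zero , Fin.suc Fin.zero , refl , s≤s () , _)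
Contains32-1⇒Has32-1 (x ∷ xs) (Fin.suc i , Fin.suc a , Fin.suc b , a≡1+i , s≤s a<b , r) =
  there (Contains32-1⇒Has32-1 xs (i , a , b , suc-injective a≡1+i , a<b , r))

Has32-1⇒Contains32-1 : ∀ {π} → Has32-1 π → Contains32-1 π
Has32-1⇒Contains32-1 (here y<x p) =
  Fin.zero , Fin.suc Fin.zero , Fin.suc (Fin.suc (Any.index p)) , refl , s≤s (s≤s z≤n) , y<x , Anyₚ.lookup-index p
Has32-1⇒Contains32-1 (there c) with Has32-1⇒Contains32-1 c
... | i , a , b , a≡1+i , a<b , r = Fin.suc i , Fin.suc a , Fin.suc b , cong suc a≡1+i , s≤s a<b , r

Has231-++⁺ˡ : ∀ {xs} ys → Has231 xs → Has231 (xs ++ ys)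
Has231-++⁺ˡ ys (here s)  = here (AnyPair-++⁺ˡ ys s)
Has231-++⁺ˡ ys (there c) = there (Has231-++⁺ˡ ys c)

Has231-++⁺ʳ : ∀ xs {ys} → Has231 ys → Has231 (xs ++ ys)
Has231-++⁺ʳ []       c = c
Has231-++⁺ʳ (x ∷ xs) c = there (Has231-++⁺ʳ xs c)

Has32-1-++⁺ˡ : ∀ {xs} ys → Has32-1 xs → Has32-1 (xs ++ ys)
Has32-1-++⁺ˡ ys (here y<x p) = here y<x (Anyₚ.++⁺ˡ p)
Has32-1-++⁺ˡ ys (there c)    = there (Has32-1-++⁺ˡ ys c)

Has32-1-++⁺ʳ : ∀ xs {ys} → Has32-1 ys → Has32-1 (xs ++ ys)
Has32-1-++⁺ʳ []       c = c
Has32-1-++⁺ʳ (x ∷ xs) c = there (Has32-1-++⁺ʳ xs c)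

Avoids-++⁻ˡ : ∀ {xs} ys → Avoids (xs ++ ys) → Avoids xs
Avoids-++⁻ˡ ys av = avoids (no231 av ∘ Has231-++⁺ˡ ys) (no32-1 av ∘ Has32-1-++⁺ˡ ys)

Avoids-++⁻ʳ : ∀ xs {ys} → Avoids (xs ++ ys) → Avoids ys
Avoids-++⁻ʳ xs av = avoids (no231 av ∘ Has231-++⁺ʳ xs) (no32-1 av ∘ Has32-1-++⁺ʳ xs)

Has231-++⁻ : ∀ xs {ys} → All (λ x → All (x <_) ys) xs → Has231 (xs ++ ys) → Has231 xs ⊎ Has231 ys
Has231-++⁻ []       _            c = inj₂ c
Has231-++⁻ (x ∷ xs) (x<ys ∷ _)   (here s) with AnyPair-++⁻ xs s
... | inj₁ s′ = inj₁ (here s′)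
... | inj₂ q  = ⊥-elim (All⇒¬Any (λ x<z (_ , z<x , _) → <-asym x<z z<x) x<ys q)
Has231-++⁻ (x ∷ xs) (_ ∷ xs<ys) (there c) with Has231-++⁻ xs xs<ys c
... | inj₁ c′ = inj₁ (there c′)
... | inj₂ c′ = inj₂ c′

Has32-1-++⁻ : ∀ xs {ys} → All (λ x → All (x <_) ys) xs → Has32-1 (xs ++ ys) → Has32-1 xs ⊎ Has32-1 ys
Has32-1-++⁻ []            _                   c              = inj₂ c
Has32-1-++⁻ (x ∷ [])      ((x<y ∷ _) ∷ _)     (here y<x _)   = ⊥-elim (<-asym x<y y<x)
Has32-1-++⁻ (x ∷ [])      _                   (there c)      = inj₂ c
Has32-1-++⁻ (x ∷ x′ ∷ xs) (_ ∷ x′<ys ∷ _)     (here x′<x p) with Anyₚ.++⁻ xs p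
... | inj₁ q = inj₁ (here x′<x q)
... | inj₂ q = ⊥-elim (All⇒¬Any (λ x′<z z<x′ → <-asym x′<z z<x′) x′<ys q)
Has32-1-++⁻ (x ∷ x′ ∷ xs) (_ ∷ x′∷xs<ys)      (there c) with Has32-1-++⁻ (x′ ∷ xs) x′∷xs<ys c
... | inj₁ c′ = inj₁ (there c′)
... | inj₂ c′ = inj₂ c′

Avoids-++⁺ : ∀ {xs ys} → All (λ x → All (x <_) ys) xs → Avoids xs → Avoids ys → Avoids (xs ++ ys)
Avoids-++⁺ {xs} xs<ys avˣ avʸ =
  avoids (λ c → [ no231 avˣ , no231 avʸ ] (Has231-++⁻ xs xs<ys c))
         (λ c → [ no32-1 avˣ , no32-1 avʸ ] (Has32-1-++⁻ xs xs<ys c))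

Avoids-min∷ : ∀ {x xs} → All (x <_) xs → Avoids xs → Avoids (x ∷ xs)
Avoids-min∷ {x} {xs} x<xs av = avoids no231′ no32-1′
  where
  no231′ : ¬ Has231 (x ∷ xs)
  no231′ (here s)  = All⇒¬Any (λ x<z (_ , z<x , _) → <-asym x<z z<x) x<xs (AnyPair-second s)
  no231′ (there c) = no231 av c
  no32-1′ : ¬ Has32-1 (x ∷ xs)
  no32-1′ (here y<x _) = <-asym y<x (All.head x<xs)
  no32-1′ (there c)    = no32-1 av c

Avoids-join : ∀ {lo v A B} → All (_< v) (lo ∷ A) → All (v <_) B → All (lo <_) (A ++ B) →
              Avoids A → Avoids B → Avoids (v ∷ lo ∷ A ++ B)
Avoids-join {lo} {v} {A} {B} lo∷A<v v<B lo<A++B avᴬ avᴮ = avoids no231′ no32-1′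
  where
  tail-avoids : Avoids (lo ∷ A ++ B)
  tail-avoids = Avoids-min∷ lo<A++B (Avoids-++⁺ (All.map (λ a<v → All.map (<-trans a<v) v<B) (All.tail lo∷A<v)) avᴬ avᴮ)
  no231′ : ¬ Has231 (v ∷ lo ∷ A ++ B)
  no231′ (here s) with AnyPair-++⁻ (lo ∷ A) s
  ... | inj₁ s′ = All⇒¬Any (λ y<v (_ , _ , v<y) → <-asym y<v v<y) lo∷A<v (AnyPair-first s′)
  ... | inj₂ q  = All⇒¬Any (λ v<z (_ , z<v , _) → <-asym v<z z<v) v<B q
  no231′ (there c) = no231 tail-avoids c
  no32-1′ : ¬ Has32-1 (v ∷ lo ∷ A ++ B)
  no32-1′ (here _ p) = All⇒¬Any (λ lo<z z<lo → <-asym lo<z z<lo) lo<A++B p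
  no32-1′ (there c)  = no32-1 tail-avoids c

record Arrangement (lo hi : ℕ) (π : List ℕ) : Set where
  constructor arrangement
  field
    unique   : Unique π
    bounded  : ∀ {x} → x ∈ π → lo ≤ x × x < hi
    complete : ∀ x → lo ≤ x → x < hi → x ∈ π

open Arrangement

record 𝔐ᴿ (lo n : ℕ) (π : List ℕ) : Set where
  constructor _⟨_⟩
  field
    arranged : Arrangement lo (lo + n) π
    avoiding : Avoids π

open 𝔐ᴿ

join : ℕ → ℕ → List ℕ → List ℕ → List ℕ
join lo m B A = suc (lo + m) ∷ lo ∷ A ++ B

join-bound : ∀ lo m i → suc (suc (lo + m)) + i ≡ lo + suc (suc (m + i))
join-bound lo m i = trans (cong (suc ∘ suc) (+-assoc lo m i)) (sym (trans (+-suc lo (suc (m + i))) (cong suc (+-suc lo (m + i)))))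

Unique-++⁻ : ∀ xs {ys : List ℕ} → Unique (xs ++ ys) → Unique xs × Unique ys
Unique-++⁻ []       u          = [] , u
Unique-++⁻ (x ∷ xs) (x∉ ∷ u) with Unique-++⁻ xs u
... | uˣ , uʸ = Allₚ.++⁻ˡ xs x∉ ∷ uˣ , uʸ

arrangement-[] : ∀ lo → Arrangement lo lo []
arrangement-[] lo = arrangement [] (λ ()) (λ x lo≤x x<lo → ⊥-elim (<⇒≱ x<lo lo≤x))

arrangement-min∷ : ∀ {lo hi R} → Arrangement (suc lo) hi R → lo < hi → Arrangement lo hi (lo ∷ R)
arrangement-min∷ {lo} {hi} {R} a lo<hi =
  arrangement (All.tabulate (λ x∈ → <⇒≢ (proj₁ (bounded a x∈))) ∷ unique a) bounded′ complete′
  where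
  bounded′ : ∀ {x} → x ∈ lo ∷ R → lo ≤ x × x < hi
  bounded′ (here refl) = ≤-refl , lo<hi
  bounded′ (there x∈)  = <⇒≤ (proj₁ (bounded a x∈)) , proj₂ (bounded a x∈)
  complete′ : ∀ x → lo ≤ x → x < hi → x ∈ lo ∷ R
  complete′ x lo≤x x<hi with lo ≟ x
  ... | yes refl = here refl
  ... | no lo≢x  = there (complete a x (≤∧≢⇒< lo≤x lo≢x) x<hi)

arrangement-min∷⁻ : ∀ {lo hi R} → Arrangement lo hi (lo ∷ R) → Arrangement (suc lo) hi R
arrangement-min∷⁻ {lo} {hi} {R} (arrangement (lo∉R ∷ u) bd cp) = arrangement u bounded′ complete′
  where
  bounded′ : ∀ {x} → x ∈ R → suc lo ≤ x × x < hi
  bounded′ x∈ = ≤∧≢⇒< (proj₁ (bd (there x∈))) (All.lookup lo∉R x∈) , proj₂ (bd (there x∈))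
  complete′ : ∀ x → suc lo ≤ x → x < hi → x ∈ R
  complete′ x lo<x x<hi with cp x (<⇒≤ lo<x) x<hi
  ... | here refl = ⊥-elim (<-irrefl refl lo<x)
  ... | there x∈  = x∈

arrangement-join : ∀ {lo v hi A B} → Arrangement (suc lo) v A → Arrangement (suc v) hi B → lo < v → v < hi →
                   Arrangement lo hi (v ∷ lo ∷ A ++ B)
arrangement-join {lo} {v} {hi} {A} {B} aᴬ aᴮ lo<v v<hi =
  arrangement (v∉ ∷ lo∉ ∷ Uniqueₚ.++⁺ (unique aᴬ) (unique aᴮ) disjoint) bounded′ complete′
  where
  in-A++B : ∀ {x} → x ∈ A ++ B → (suc lo ≤ x × x < v) ⊎ (suc v ≤ x × x < hi)
  in-A++B x∈ with ∈-++⁻ A x∈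
  ... | inj₁ x∈A = inj₁ (bounded aᴬ x∈A)
  ... | inj₂ x∈B = inj₂ (bounded aᴮ x∈B)
  lo<A++B : ∀ {x} → x ∈ A ++ B → lo < x
  lo<A++B x∈ with in-A++B x∈
  ... | inj₁ (lo<x , _) = lo<x
  ... | inj₂ (v<x , _)  = <-trans lo<v v<x
  v∉A++B : ∀ {x} → x ∈ A ++ B → v ≢ x
  v∉A++B x∈ refl with in-A++B x∈
  ... | inj₁ (_ , v<v) = <-irrefl refl v<v
  ... | inj₂ (v<v , _) = <-irrefl refl v<v
  v∉ : All (v ≢_) (lo ∷ A ++ B)
  v∉ = (λ v≡lo → <-irrefl (sym v≡lo) lo<v) ∷ All.tabulate v∉A++B
  lo∉ : All (lo ≢_) (A ++ B)
  lo∉ = All.tabulate (<⇒≢ ∘ lo<A++B)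
  disjoint : ∀ {x} → ¬ (x ∈ A × x ∈ B)
  disjoint (x∈A , x∈B) = <-asym (proj₂ (bounded aᴬ x∈A)) (proj₁ (bounded aᴮ x∈B))
  bounded′ : ∀ {x} → x ∈ v ∷ lo ∷ A ++ B → lo ≤ x × x < hi
  bounded′ (here refl)         = <⇒≤ lo<v , v<hi
  bounded′ (there (here refl)) = ≤-refl , <-trans lo<v v<hi
  bounded′ (there (there x∈)) with in-A++B x∈
  ... | inj₁ (lo<x , x<v) = <⇒≤ lo<x , <-trans x<v v<hi
  ... | inj₂ (v<x , x<hi) = <⇒≤ (<-trans lo<v v<x) , x<hi
  complete′ : ∀ x → lo ≤ x → x < hi → x ∈ v ∷ lo ∷ A ++ B
  complete′ x lo≤x x<hi with <-cmp x v
  ... | tri≈ _ refl _ = here refl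
  ... | tri> _ _ v<x  = there (there (∈-++⁺ʳ A (complete aᴮ x v<x x<hi)))
  ... | tri< x<v _ _ with lo ≟ x
  ...   | yes refl = there (here refl)
  ...   | no lo≢x  = there (there (∈-++⁺ˡ (complete aᴬ x (≤∧≢⇒< lo≤x lo≢x) x<v)))

arrangement-join⁻ : ∀ {lo v hi A B} → Arrangement lo hi (v ∷ lo ∷ A ++ B) → All (_< v) A → All (v <_) B →
                    Arrangement (suc lo) v A × Arrangement (suc v) hi B
arrangement-join⁻ {lo} {v} {hi} {A} {B} (arrangement ((v≢lo ∷ _) ∷ lo∉A++B ∷ u) bd cp) A<v v<B =
  arrangement (proj₁ (Unique-++⁻ A u)) boundedᴬ completeᴬ ,
  arrangement (proj₂ (Unique-++⁻ A u)) boundedᴮ completeᴮ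
  where
  v<hi : v < hi
  v<hi = proj₂ (bd (here refl))
  lo<v : lo < v
  lo<v = ≤∧≢⇒< (proj₁ (bd (here refl))) (v≢lo ∘ sym)
  boundedᴬ : ∀ {x} → x ∈ A → suc lo ≤ x × x < v
  boundedᴬ x∈ =
    ≤∧≢⇒< (proj₁ (bd (there (there (∈-++⁺ˡ x∈))))) (All.lookup lo∉A++B (∈-++⁺ˡ x∈)) , All.lookup A<v x∈
  completeᴬ : ∀ x → suc lo ≤ x → x < v → x ∈ A
  completeᴬ x lo<x x<v with cp x (<⇒≤ lo<x) (<-trans x<v v<hi)
  ... | here refl          = ⊥-elim (<-irrefl refl x<v)
  ... | there (here refl)  = ⊥-elim (<-irrefl refl lo<x)
  ... | there (there x∈) with ∈-++⁻ A x∈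
  ...   | inj₁ x∈A = x∈A
  ...   | inj₂ x∈B = ⊥-elim (<-asym x<v (All.lookup v<B x∈B))
  boundedᴮ : ∀ {x} → x ∈ B → suc v ≤ x × x < hi
  boundedᴮ x∈ = All.lookup v<B x∈ , proj₂ (bd (there (there (∈-++⁺ʳ A x∈))))
  completeᴮ : ∀ x → suc v ≤ x → x < hi → x ∈ B
  completeᴮ x v<x x<hi with cp x (<⇒≤ (<-trans lo<v v<x)) x<hi
  ... | here refl          = ⊥-elim (<-irrefl refl v<x)
  ... | there (here refl)  = ⊥-elim (<-asym lo<v v<x)
  ... | there (there x∈) with ∈-++⁻ A x∈
  ...   | inj₁ x∈A = ⊥-elim (<-asym v<x (All.lookup A<v x∈A))
  ...   | inj₂ x∈B = x∈B

lo<lo+suc : ∀ lo n → lo < lo + suc n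
lo<lo+suc lo n = ≤-<-trans (m≤m+n lo n) (+-monoʳ-< lo ≤-refl)

𝔐ᴿ-[] : ∀ lo → 𝔐ᴿ lo 0 []
𝔐ᴿ-[] lo = subst (λ hi → Arrangement lo hi []) (sym (+-identityʳ lo)) (arrangement-[] lo) ⟨ avoids (λ ()) (λ ()) ⟩

𝔐ᴿ-min∷ : ∀ {lo n R} → 𝔐ᴿ (suc lo) n R → 𝔐ᴿ lo (suc n) (lo ∷ R)
𝔐ᴿ-min∷ {lo} {n} {R} (a ⟨ av ⟩) =
  arrangement-min∷ (subst (λ hi → Arrangement (suc lo) hi R) (sym (+-suc lo n)) a) (lo<lo+suc lo n)
  ⟨ Avoids-min∷ (All.tabulate (proj₁ ∘ bounded a)) av ⟩

𝔐ᴿ-min∷⁻ : ∀ {lo n R} → 𝔐ᴿ lo (suc n) (lo ∷ R) → 𝔐ᴿ (suc lo) n R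
𝔐ᴿ-min∷⁻ {lo} {n} {R} (a ⟨ av ⟩) =
  subst (λ hi → Arrangement (suc lo) hi R) (+-suc lo n) (arrangement-min∷⁻ a) ⟨ Avoids-++⁻ʳ (lo ∷ []) av ⟩

𝔐ᴿ-join : ∀ {lo m i A B} → 𝔐ᴿ (suc lo) m A → 𝔐ᴿ (suc (suc (lo + m))) i B →
          𝔐ᴿ lo (suc (suc (m + i))) (join lo m B A)
𝔐ᴿ-join {lo} {m} {i} {A} {B} (aᴬ ⟨ avᴬ ⟩) (aᴮ ⟨ avᴮ ⟩) =
  arrangement-join aᴬ (subst (λ hi → Arrangement (suc v) hi B) (join-bound lo m i) aᴮ) lo<v
                   (subst (v <_) (join-bound lo m i) (m≤m+n (suc v) i))
  ⟨ Avoids-join (lo<v ∷ All.tabulate (proj₂ ∘ bounded aᴬ)) (All.tabulate (proj₁ ∘ bounded aᴮ))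
                (All.tabulate lo<A++B) avᴬ avᴮ ⟩
  where
  v : ℕ
  v = suc (lo + m)
  lo<v : lo < v
  lo<v = s≤s (m≤m+n lo m)
  lo<A++B : ∀ {x} → x ∈ A ++ B → lo < x
  lo<A++B x∈ with ∈-++⁻ A x∈
  ... | inj₁ x∈A = proj₁ (bounded aᴬ x∈A)
  ... | inj₂ x∈B = <-trans lo<v (proj₁ (bounded aᴮ x∈B))

data Shape (lo : ℕ) : ℕ → List ℕ → Set where
  starts-min : ∀ {n R} → 𝔐ᴿ (suc lo) n R → Shape lo (suc n) (lo ∷ R)
  joined     : ∀ {m i A B} → 𝔐ᴿ (suc lo) m A → 𝔐ᴿ (suc (suc (lo + m))) i B →
               Shape lo (suc (suc (m + i))) (join lo m B A)

Shape⇒𝔐ᴿ : ∀ {lo n π} → Shape lo n π → 𝔐ᴿ lo n π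
Shape⇒𝔐ᴿ (starts-min p) = 𝔐ᴿ-min∷ p
Shape⇒𝔐ᴿ (joined pᴬ pᴮ) = 𝔐ᴿ-join pᴬ pᴮ

-- If π does not start with its minimum lo, then lo comes second: otherwise π₀ π₁ lo is a 231 or a 32-1.
second-is-min : ∀ {lo n v rest} → 𝔐ᴿ lo (suc n) (v ∷ rest) → v ≢ lo → ∃[ ys ] rest ≡ lo ∷ ys
second-is-min {lo} {n} {v} {[]} (a ⟨ _ ⟩) v≢lo with complete a lo ≤-refl (lo<lo+suc lo n)
... | here lo≡v = ⊥-elim (v≢lo (sym lo≡v))
second-is-min {lo} {n} {v} {y ∷ ys} (a ⟨ av ⟩) v≢lo with y ≟ lo
... | yes refl = ys , refl
... | no y≢lo  = ⊥-elim contradiction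
  where
  lo∈ys : lo ∈ ys
  lo∈ys with complete a lo ≤-refl (lo<lo+suc lo n)
  ... | here lo≡v          = ⊥-elim (v≢lo (sym lo≡v))
  ... | there (here lo≡y)  = ⊥-elim (y≢lo (sym lo≡y))
  ... | there (there lo∈)  = lo∈
  lo<v : lo < v
  lo<v = ≤∧≢⇒< (proj₁ (bounded a (here refl))) (v≢lo ∘ sym)
  lo<y : lo < y
  lo<y = ≤∧≢⇒< (proj₁ (bounded a (there (here refl)))) (y≢lo ∘ sym)
  contradiction : ⊥
  contradiction with <-cmp y v | unique a
  ... | tri< y<v _ _ | _               = no32-1 av (here y<v (lose lo∈ys lo<y))
  ... | tri≈ _ refl _ | (v≢y ∷ _) ∷ _  = v≢y refl
  ... | tri> _ _ v<y | _               = no231 av (here (here (lose lo∈ys (lo<v , v<y))))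

join-sizes : ∀ {lo v n} → lo < v → v < lo + suc n → ∃[ m ] ∃[ i ] (suc (lo + m) ≡ v × suc (suc (m + i)) ≡ suc n)
join-sizes {lo} {v} {n} lo<v v<hi = m , n ∸ suc m , m+[n∸m]≡n lo<v , cong suc (m+[n∸m]≡n m<n)
  where
  m : ℕ
  m = v ∸ suc lo
  m<n : suc m ≤ n
  m<n = +-cancelˡ-≤ lo (suc m) n
          (≤-pred (subst₂ _<_ (trans (sym (m+[n∸m]≡n lo<v)) (sym (+-suc lo m))) (+-suc lo n) v<hi))

-- An entry below v after the first entry y of B would make v y _ a 231.
above-pivot : ∀ {v} B → MaybeAll.All (λ y → ¬ y < v) (head B) → All (v ≢_) B →
              ¬ AnyPair (λ y z → z < v × v < y) B → All (v <_) B
above-pivot []       _           _            _       = []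
above-pivot {v} (y ∷ zs) (just y≮v) (v≢y ∷ v∉zs) no-pair =
  above (y≮v , v≢y) ∷ All.zipWith above (¬Any⇒All¬ zs (no-pair ∘ here ∘ Any.map (_, above (y≮v , v≢y))) , v∉zs)
  where
  above : ∀ {z} → ¬ z < v × v ≢ z → v < z
  above (z≮v , v≢z) = ≤∧≢⇒< (≮⇒≥ z≮v) v≢z

joined-shape : ∀ {lo m i ys} → 𝔐ᴿ lo (suc (suc (m + i))) (suc (lo + m) ∷ lo ∷ ys) →
               Shape lo (suc (suc (m + i))) (suc (lo + m) ∷ lo ∷ ys)
joined-shape {lo} {m} {i} {ys} p =
  subst (λ ys → Shape lo _ (v ∷ lo ∷ ys)) (takeWhile++dropWhile (_<? v) ys) (joined (aᴬ ⟨ avᴬ ⟩) (aᴮ ⟨ avᴮ ⟩))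
  where
  v : ℕ
  v = suc (lo + m)
  A B : List ℕ
  A = takeWhile (_<? v) ys
  B = dropWhile (_<? v) ys
  p′ : 𝔐ᴿ lo (suc (suc (m + i))) (v ∷ lo ∷ A ++ B)
  p′ = subst (λ ys → 𝔐ᴿ lo _ (v ∷ lo ∷ ys)) (sym (takeWhile++dropWhile (_<? v) ys)) p
  v∉B : All (v ≢_) B
  v∉B with unique (arranged p′)
  ... | (_ ∷ v∉A++B) ∷ _ = Allₚ.++⁻ʳ A v∉A++B
  v<B : All (v <_) B
  v<B = above-pivot B (Allₚ.all-head-dropWhile (_<? v) ys) v∉B
          (λ s → no231 (avoiding p′) (here (AnyPair-++⁺ʳ (lo ∷ A) s)))
  blocks : Arrangement (suc lo) v A × Arrangement (suc v) (lo + suc (suc (m + i))) B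
  blocks = arrangement-join⁻ (arranged p′) (Allₚ.all-takeWhile (_<? v) ys) v<B
  aᴬ : Arrangement (suc lo) (suc lo + m) A
  aᴬ = proj₁ blocks
  aᴮ : Arrangement (suc (suc (lo + m))) (suc (suc (lo + m)) + i) B
  aᴮ = subst (λ hi → Arrangement (suc v) hi B) (sym (join-bound lo m i)) (proj₂ blocks)
  avᴬ : Avoids A
  avᴬ = Avoids-++⁻ˡ B (Avoids-++⁻ʳ (v ∷ lo ∷ []) (avoiding p′))
  avᴮ : Avoids B
  avᴮ = Avoids-++⁻ʳ (v ∷ lo ∷ A) (avoiding p′)

𝔐ᴿ⇒Shape : ∀ {lo n π} → 𝔐ᴿ lo (suc n) π → Shape lo (suc n) π
𝔐ᴿ⇒Shape {lo} {n} {[]} p with complete (arranged p) lo ≤-refl (lo<lo+suc lo n)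
... | ()
𝔐ᴿ⇒Shape {lo} {n} {v ∷ rest} p with v ≟ lo
... | yes refl = starts-min (𝔐ᴿ-min∷⁻ p)
... | no v≢lo with second-is-min p v≢lo
...   | ys , refl with join-sizes (≤∧≢⇒< (proj₁ (bounded (arranged p) (here refl))) (v≢lo ∘ sym))
                                  (proj₂ (bounded (arranged p) (here refl)))
...     | m , i , refl , refl = joined-shape p

-- Enumerating and counting 𝔐ᴿ

Unique⇒↭ : ∀ {A : Set} {xs ys : List A} → Unique xs → Unique ys →
           (∀ {x} → x ∈ xs → x ∈ ys) → (∀ {x} → x ∈ ys → x ∈ xs) → xs ↭ ys
Unique⇒↭ uˣ uʸ to from = ∼bag⇒↭ (unique∧set⇒bag uˣ uʸ (mk⇔ to from))

𝔐ᴿ-length : ∀ {lo n π} → 𝔐ᴿ lo n π → length π ≡ n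
𝔐ᴿ-length {lo} {n} {π} p = trans (↭-length (Unique⇒↭ (unique a) range-unique to from)) (length-applyUpTo (_+_ lo) n)
  where
  a : Arrangement lo (lo + n) π
  a = arranged p
  range-unique : Unique (applyUpTo (_+_ lo) n)
  range-unique = Uniqueₚ.applyUpTo⁺₁ (_+_ lo) n (λ i<j _ → <⇒≢ i<j ∘ +-cancelˡ-≡ lo _ _)
  to : ∀ {x} → x ∈ π → x ∈ applyUpTo (_+_ lo) n
  to {x} x∈ = subst (_∈ applyUpTo (_+_ lo) n) lo+[x∸lo]≡x
                (∈-applyUpTo⁺ (_+_ lo) (+-cancelˡ-< lo _ n (subst (_< lo + n) (sym lo+[x∸lo]≡x) (proj₂ (bounded a x∈)))))
    where
    lo+[x∸lo]≡x : lo + (x ∸ lo) ≡ x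
    lo+[x∸lo]≡x = m+[n∸m]≡n (proj₁ (bounded a x∈))
  from : ∀ {x} → x ∈ applyUpTo (_+_ lo) n → x ∈ π
  from x∈ with ∈-applyUpTo⁻ (_+_ lo) x∈
  ... | i , i<n , refl = complete a (lo + i) (m≤m+n lo i) (+-monoʳ-< lo i<n)

-- The first argument is fuel: enum f lo n lists 𝔐ᴿ lo n exactly when n < f.
enum : ℕ → ℕ → ℕ → List (List ℕ)
joins : ℕ → ℕ → ℕ → List (List ℕ)
joinBlock : ℕ → ℕ → ℕ → ℕ → List (List ℕ)

enum zero    lo n       = []
enum (suc f) lo zero    = [] ∷ []
enum (suc f) lo (suc n) = map (lo ∷_) (enum f (suc lo) n) ++ joins f lo n

joins f lo zero    = []
joins f lo (suc N) = concat (applyUpTo (joinBlock f lo N) (suc N))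

joinBlock f lo N i = cartesianProductWith (join lo (N ∸ i)) (enum f (suc (suc (lo + (N ∸ i)))) i) (enum f (suc lo) (N ∸ i))

∈-joinBlock⁻ : ∀ f lo N i {π} → π ∈ joinBlock f lo N i →
               ∃[ B ] ∃[ A ] (B ∈ enum f (suc (suc (lo + (N ∸ i)))) i × A ∈ enum f (suc lo) (N ∸ i) ×
                              π ≡ join lo (N ∸ i) B A)
∈-joinBlock⁻ f lo N i = ∈-cartesianProductWith⁻ (join lo (N ∸ i)) _ _

∈-joins⁻ : ∀ f lo N {π} → π ∈ joins f lo (suc N) → ∃[ i ] (i ≤ N × π ∈ joinBlock f lo N i)
∈-joins⁻ f lo N π∈ with ∈-concat⁻′ _ π∈
... | xs , π∈xs , xs∈ with ∈-applyUpTo⁻ (joinBlock f lo N) xs∈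
...   | i , s≤s i≤N , refl = i , i≤N , π∈xs

enum-sound : ∀ f lo n {π} → π ∈ enum f lo n → 𝔐ᴿ lo n π
joins-sound : ∀ f lo n {π} → π ∈ joins f lo n → 𝔐ᴿ lo (suc n) π

enum-sound (suc f) lo zero    (here refl) = 𝔐ᴿ-[] lo
enum-sound (suc f) lo (suc n) π∈ with ∈-++⁻ (map (lo ∷_) (enum f (suc lo) n)) π∈
... | inj₂ π∈joins = joins-sound f lo n π∈joins
... | inj₁ π∈heads with ∈-map⁻ (lo ∷_) π∈heads
...   | R , R∈ , refl = Shape⇒𝔐ᴿ (starts-min (enum-sound f (suc lo) n R∈))

joins-sound f lo (suc N) π∈ with ∈-joins⁻ f lo N π∈
... | i , i≤N , π∈block with ∈-joinBlock⁻ f lo N i π∈block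
...   | B , A , B∈ , A∈ , refl =
  subst (λ n → 𝔐ᴿ lo (suc (suc n)) (join lo (N ∸ i) B A)) (m∸n+n≡m i≤N)
        (Shape⇒𝔐ᴿ (joined (enum-sound f (suc lo) (N ∸ i) A∈) (enum-sound f _ i B∈)))

∈-joins⁺ : ∀ f lo m i {A B} → A ∈ enum f (suc lo) m → B ∈ enum f (suc (suc (lo + m))) i →
           join lo m B A ∈ joins f lo (suc (m + i))
∈-joins⁺ f lo m i {A} {B} A∈ B∈ =
  ∈-concat⁺′ (subst (λ m′ → join lo m B A ∈ cartesianProductWith (join lo m′) (enum f (suc (suc (lo + m′))) i)
                                                                              (enum f (suc lo) m′))
                    (sym (m+n∸n≡m m i)) (∈-cartesianProductWith⁺ (join lo m) B∈ A∈))
             (∈-applyUpTo⁺ (joinBlock f lo (m + i)) (s≤s (m≤n+m i m)))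

enum-complete : ∀ f lo n {π} → n < f → 𝔐ᴿ lo n π → π ∈ enum f lo n
enum-complete (suc f) lo zero    {[]}    _ _ = here refl
enum-complete (suc f) lo zero    {_ ∷ _} _ p with 𝔐ᴿ-length p
... | ()
enum-complete (suc f) lo (suc n) (s≤s n<f) p with 𝔐ᴿ⇒Shape p
... | starts-min q = ∈-++⁺ˡ (∈-map⁺ (lo ∷_) (enum-complete f (suc lo) n n<f q))
... | joined {m} {i} qᴬ qᴮ = ∈-++⁺ʳ (map (lo ∷_) (enum f (suc lo) n))
  (∈-joins⁺ f lo m i (enum-complete f (suc lo) m (≤-<-trans (m≤m+n m i) m+i<f) qᴬ)
                     (enum-complete f _ i (≤-<-trans (m≤n+m i m) m+i<f) qᴮ))
  where
  m+i<f : m + i < f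
  m+i<f = <-trans (n<1+n (m + i)) n<f

Unique-map⁺-on : ∀ {A B : Set} (g : A → B) {xs} → Unique xs →
                 (∀ {a a′} → a ∈ xs → a′ ∈ xs → g a ≡ g a′ → a ≡ a′) → Unique (map g xs)
Unique-map⁺-on g {[]}     []       _   = []
Unique-map⁺-on g {x ∷ xs} (x∉ ∷ u) inj = All.tabulate fresh ∷ Unique-map⁺-on g u (λ a a′ → inj (there a) (there a′))
  where
  fresh : ∀ {y} → y ∈ map g xs → g x ≢ y
  fresh y∈ gx≡y with ∈-map⁻ g y∈
  ... | a , a∈ , refl = All.lookup x∉ a∈ (inj (here refl) (there a∈) gx≡y)

Unique-cartesianProductWith⁺-on : ∀ {A B C : Set} (f : A → B → C) {xs ys} → Unique xs → Unique ys →
  (∀ {a a′ b b′} → a ∈ xs → a′ ∈ xs → b ∈ ys → b′ ∈ ys → f a b ≡ f a′ b′ → a ≡ a′ × b ≡ b′) →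
  Unique (cartesianProductWith f xs ys)
Unique-cartesianProductWith⁺-on f {[]}     _        _  _   = []
Unique-cartesianProductWith⁺-on f {x ∷ xs} {ys} (x∉ ∷ u) uʸ inj =
  Uniqueₚ.++⁺ (Unique-map⁺-on (f x) uʸ (λ b b′ → proj₂ ∘ inj (here refl) (here refl) b b′))
              (Unique-cartesianProductWith⁺-on f u uʸ (λ a a′ → inj (there a) (there a′)))
              disjoint
  where
  disjoint : ∀ {z} → ¬ (z ∈ map (f x) ys × z ∈ cartesianProductWith f xs ys)
  disjoint (z∈row , z∈rest) with ∈-map⁻ (f x) z∈row | ∈-cartesianProductWith⁻ f xs ys z∈rest
  ... | b , b∈ , refl | a′ , b′ , a′∈ , b′∈ , e =
    All.lookup x∉ a′∈ (proj₁ (inj (here refl) (there a′∈) b∈ b′∈ e))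

++-injective : ∀ (xs xs′ : List ℕ) {ys ys′} → length xs ≡ length xs′ → xs ++ ys ≡ xs′ ++ ys′ →
               xs ≡ xs′ × ys ≡ ys′
++-injective []       []         _ e = refl , e
++-injective (x ∷ xs) (x′ ∷ xs′) l e with ∷-injective e
... | refl , e′ with ++-injective xs xs′ (suc-injective l) e′
...   | refl , e″ = refl , e″

joins-head : ∀ f lo n {π} → π ∈ joins f lo n → ∃[ m ] ∃[ t ] π ≡ suc (lo + m) ∷ t
joins-head f lo (suc N) π∈ with ∈-joins⁻ f lo N π∈
... | i , _ , π∈block with ∈-joinBlock⁻ f lo N i π∈block
...   | B , A , _ , _ , refl = N ∸ i , lo ∷ A ++ B , refl

enum-unique : ∀ f lo n → Unique (enum f lo n)
joins-unique : ∀ f lo n → Unique (joins f lo n)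

enum-unique zero    lo n       = []
enum-unique (suc f) lo zero    = [] ∷ []
enum-unique (suc f) lo (suc n) =
  Uniqueₚ.++⁺ (Uniqueₚ.map⁺ ∷-injectiveʳ (enum-unique f (suc lo) n)) (joins-unique f lo n) disjoint
  where
  disjoint : ∀ {π} → ¬ (π ∈ map (lo ∷_) (enum f (suc lo) n) × π ∈ joins f lo n)
  disjoint (π∈heads , π∈joins) with ∈-map⁻ (lo ∷_) π∈heads | joins-head f lo n π∈joins
  ... | _ , _ , refl | m , _ , e = <-irrefl (∷-injectiveˡ e) (s≤s (m≤m+n lo m))

joins-unique f lo zero    = []
joins-unique f lo (suc N) =
  Uniqueₚ.concat⁺ (Allₚ.applyUpTo⁺₁ (joinBlock f lo N) (suc N) (λ _ → block-unique _))
                  (AllPairsₚ.applyUpTo⁺₁ (joinBlock f lo N) (suc N) (λ i<j j<1+N → blocks-disjoint i<j (≤-pred j<1+N)))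
  where
  block-unique : ∀ i → Unique (joinBlock f lo N i)
  block-unique i = Unique-cartesianProductWith⁺-on (join lo (N ∸ i)) (enum-unique f _ i) (enum-unique f (suc lo) (N ∸ i))
    λ _ _ A∈ A′∈ e → swap (++-injective _ _ (trans (𝔐ᴿ-length (enum-sound f _ _ A∈)) (sym (𝔐ᴿ-length (enum-sound f _ _ A′∈))))
                                        (∷-injectiveʳ (∷-injectiveʳ e)))
  blocks-disjoint : ∀ {i j} → i < j → j ≤ N → ∀ {π} → ¬ (π ∈ joinBlock f lo N i × π ∈ joinBlock f lo N j)
  blocks-disjoint {i} {j} i<j j≤N (π∈i , π∈j) with ∈-joinBlock⁻ f lo N i π∈i | ∈-joinBlock⁻ f lo N j π∈j
  ... | _ , _ , _ , _ , refl | _ , _ , _ , _ , e =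
    <⇒≢ i<j (∸-cancelˡ-≡ (≤-trans (<⇒≤ i<j) j≤N) j≤N (+-cancelˡ-≡ lo _ _ (suc-injective (∷-injectiveˡ e))))

count : (List ℕ → ℕ) → List (List ℕ) → ℕ → ℕ
count s []      k = 0
count s (π ∷ L) k = δ (s π) k + count s L k

count-++ : ∀ s xs ys k → count s (xs ++ ys) k ≡ count s xs k + count s ys k
count-++ s []       ys k = refl
count-++ s (π ∷ xs) ys k = trans (cong (_+_ (δ (s π) k)) (count-++ s xs ys k)) (sym (+-assoc (δ (s π) k) _ _))

count-map : ∀ s (g : List ℕ → List ℕ) L k → count s (map g L) k ≡ count (s ∘ g) L k
count-map s g []      k = refl
count-map s g (π ∷ L) k = cong (_+_ (δ (s (g π)) k)) (count-map s g L k)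

count-cong : ∀ {s s′} L k → (∀ {π} → π ∈ L → s π ≡ s′ π) → count s L k ≡ count s′ L k
count-cong []      k eq = refl
count-cong (π ∷ L) k eq = cong₂ _+_ (cong (λ t → δ t k) (eq (here refl))) (count-cong L k (eq ∘ there))

count-shift : ∀ t s L k → count (λ π → t + s π) L k ≡ shiftℕ t (count s L) k
count-shift zero    s L       k       = refl
count-shift (suc t) s []      zero    = refl
count-shift (suc t) s (π ∷ L) zero    = count-shift (suc t) s L zero
count-shift (suc t) s L       (suc k) = trans (lower L) (count-shift t s L k)
  where
  lower : ∀ L → count (λ π → suc t + s π) L (suc k) ≡ count (λ π → t + s π) L k
  lower []      = refl
  lower (π ∷ L) = cong (_+_ (δ (t + s π) k)) (lower L)

count-concat : ∀ s N (g : ℕ → List (List ℕ)) k → count s (concat (applyUpTo g (suc N))) k ≡ sumℕ N (λ i → count s (g i) k)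
count-concat s zero    g k = trans (count-++ s (g 0) [] k) (+-identityʳ _)
count-concat s (suc N) g k = begin
  count s (g 0 ++ concat (applyUpTo (g ∘ suc) (suc N))) k
    ≡⟨ count-++ s (g 0) _ k ⟩
  count s (g 0) k + count s (concat (applyUpTo (g ∘ suc) (suc N))) k
    ≡⟨ cong (_+_ (count s (g 0) k)) (count-concat s N (g ∘ suc) k) ⟩
  count s (g 0) k + sumℕ N (λ i → count s (g (suc i)) k)
    ≡⟨ sumℕ-peel N (λ i → count s (g i) k) ⟨
  sumℕ (suc N) (λ i → count s (g i) k) ∎
  where open ≡-Reasoning

count-cartesianProductWith : ∀ f (s sᴮ sᴬ : List ℕ → ℕ) t LB LA →
  (∀ {B A} → B ∈ LB → A ∈ LA → s (f B A) ≡ t + (sᴮ B + sᴬ A)) →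
  ∀ k → count s (cartesianProductWith f LB LA) k ≡ shiftℕ t (count sᴮ LB ⊛ count sᴬ LA) k
count-cartesianProductWith f s sᴮ sᴬ t [] LA _ k = sym (trans (shift-cong t sumℕ-zero k) (shift-padding t k))
count-cartesianProductWith f s sᴮ sᴬ t (B ∷ LB) LA s≡ k = begin
  count s (map (f B) LA ++ cartesianProductWith f LB LA) k
    ≡⟨ count-++ s (map (f B) LA) _ k ⟩
  count s (map (f B) LA) k + count s (cartesianProductWith f LB LA) k
    ≡⟨ cong₂ _+_ row (count-cartesianProductWith f s sᴮ sᴬ t LB LA (s≡ ∘ there) k) ⟩
  shiftℕ t (shiftℕ (sᴮ B) (count sᴬ LA)) k + shiftℕ t (count sᴮ LB ⊛ count sᴬ LA) k
    ≡⟨ shift-zipWith _+_ refl t _ _ k ⟩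
  shiftℕ t (λ j → shiftℕ (sᴮ B) (count sᴬ LA) j + (count sᴮ LB ⊛ count sᴬ LA) j) k
    ≡⟨ shift-cong t (λ j → trans (cong (_+ (count sᴮ LB ⊛ count sᴬ LA) j) (sym (δ-⊛ (sᴮ B) _ j)))
                                 (sym (⊛-distribʳ-+ (δ (sᴮ B)) (count sᴮ LB) (count sᴬ LA) j))) k ⟩
  shiftℕ t (count sᴮ (B ∷ LB) ⊛ count sᴬ LA) k ∎
  where
  open ≡-Reasoning
  row : count s (map (f B) LA) k ≡ shiftℕ t (shiftℕ (sᴮ B) (count sᴬ LA)) k
  row = begin
    count s (map (f B) LA) k                    ≡⟨ count-map s (f B) LA k ⟩
    count (s ∘ f B) LA k
      ≡⟨ count-cong LA k (λ A∈ → trans (s≡ (here refl) A∈) (sym (+-assoc t (sᴮ B) _))) ⟩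
    count (λ A → (t + sᴮ B) + sᴬ A) LA k        ≡⟨ count-shift (t + sᴮ B) sᴬ LA k ⟩
    shiftℕ (t + sᴮ B) (count sᴬ LA) k           ≡⟨ shift-shift t (sᴮ B) _ k ⟨
    shiftℕ t (shiftℕ (sᴮ B) (count sᴬ LA)) k    ∎

count-const : ∀ c L k → count (λ _ → c) L k ≡ δ c k * length L
count-const c []      k = sym (*-zeroʳ (δ c k))
count-const c (π ∷ L) k = trans (cong (_+_ (δ c k)) (count-const c L k)) (sym (*-suc (δ c k) (length L)))

fpFrom-++ : ∀ c xs ys → fpFrom c (xs ++ ys) ≡ fpFrom c xs + fpFrom (c + length xs) ys
fpFrom-++ c []       ys = cong (λ t → fpFrom t ys) (sym (+-identityʳ c))
fpFrom-++ c (x ∷ xs) ys = begin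
  δ x c + fpFrom (suc c) (xs ++ ys)
    ≡⟨ cong (_+_ (δ x c)) (fpFrom-++ (suc c) xs ys) ⟩
  δ x c + (fpFrom (suc c) xs + fpFrom (suc c + length xs) ys)
    ≡⟨ +-assoc (δ x c) _ _ ⟨
  δ x c + fpFrom (suc c) xs + fpFrom (suc (c + length xs)) ys
    ≡⟨ cong (λ t → δ x c + fpFrom (suc c) xs + fpFrom t ys) (+-suc c (length xs)) ⟨
  δ x c + fpFrom (suc c) xs + fpFrom (c + suc (length xs)) ys ∎
  where open ≡-Reasoning

fpFrom-below : ∀ c xs → (∀ {x} → x ∈ xs → x < c) → fpFrom c xs ≡ 0
fpFrom-below c []       _     = refl
fpFrom-below c (x ∷ xs) xs<c =
  cong₂ _+_ (δ-≢ (<⇒≢ (xs<c (here refl)))) (fpFrom-below (suc c) xs (m<n⇒m<1+n ∘ xs<c ∘ there))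

δ-+ : ∀ lo x y → δ (lo + x) (lo + y) ≡ δ x y
δ-+ zero     x y = refl
δ-+ (suc lo) x y = δ-+ lo x y

-- In join lo m B A the entries of A sit at positions 2, 3, … and those of B at positions m + 2, …
fpFrom-join : ∀ lo d m B A → length A ≡ m →
  fpFrom (lo + d) (join lo m B A) ≡ δ (suc m) d + (fpFrom (suc (suc (lo + m)) + d) B + fpFrom (suc lo + suc d) A)
fpFrom-join lo d m B A |A|≡m = begin
  δ (suc (lo + m)) (lo + d) + (δ lo (suc (lo + d)) + fpFrom (suc (suc (lo + d))) (A ++ B))
    ≡⟨ cong₂ (λ a b → a + (b + fpFrom (suc (suc (lo + d))) (A ++ B)))
             (trans (cong (λ t → δ t (lo + d)) (sym (+-suc lo m))) (δ-+ lo (suc m) d))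
             (δ-≢ (<⇒≢ (s≤s (m≤m+n lo d)))) ⟩
  δ (suc m) d + fpFrom (suc (suc (lo + d))) (A ++ B)
    ≡⟨ cong (_+_ (δ (suc m) d)) (fpFrom-++ (suc (suc (lo + d))) A B) ⟩
  δ (suc m) d + (fpFrom (suc (suc (lo + d))) A + fpFrom (suc (suc (lo + d)) + length A) B)
    ≡⟨ cong (_+_ (δ (suc m) d)) (trans (+-comm (fpFrom (suc (suc (lo + d))) A) _)
                                       (cong₂ _+_ (cong (λ t → fpFrom t B) offsetᴮ) (cong (λ t → fpFrom t A) offsetᴬ))) ⟩
  δ (suc m) d + (fpFrom (suc (suc (lo + m)) + d) B + fpFrom (suc lo + suc d) A) ∎
  where
  open ≡-Reasoning
  offsetᴮ : suc (suc (lo + d)) + length A ≡ suc (suc (lo + m)) + d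
  offsetᴮ = cong (suc ∘ suc) (trans (cong (_+_ (lo + d)) |A|≡m)
                              (trans (+-assoc lo d m) (trans (cong (_+_ lo) (+-comm d m)) (sym (+-assoc lo m d)))))
  offsetᴬ : suc (suc (lo + d)) ≡ suc lo + suc d
  offsetᴬ = cong suc (sym (+-suc lo d))

enumCount : ℕ → ℕ → ℕ → ℕ → ℕ → ℕ
enumCount f lo d n = count (fpFrom (lo + d)) (enum f lo n)

joinCount : ℕ → ℕ → ℕ → ℕ → ℕ → ℕ
joinCount f lo d N k =
  sumℕ N (λ i → shiftℕ (δ (suc (N ∸ i)) d)
                       (enumCount f (suc (suc (lo + (N ∸ i)))) d i ⊛ enumCount f (suc lo) (suc d) (N ∸ i)) k)

enumCount-zero : ∀ f lo d k → enumCount (suc f) lo d 0 k ≡ δ 0 k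
enumCount-zero f lo d k = +-identityʳ (δ 0 k)

enumCount-suc : ∀ f lo d n k →
  enumCount (suc f) lo d (suc n) k ≡ shiftℕ (δ 0 d) (enumCount f (suc lo) d n) k + shiftℕ 1 (λ N → joinCount f lo d N k) n
enumCount-suc f lo d n k =
  trans (count-++ (fpFrom (lo + d)) (map (lo ∷_) (enum f (suc lo) n)) (joins f lo n) k) (cong₂ _+_ starting-min (joining n))
  where
  starting-min : count (fpFrom (lo + d)) (map (lo ∷_) (enum f (suc lo) n)) k ≡ shiftℕ (δ 0 d) (enumCount f (suc lo) d n) k
  starting-min =
    trans (count-map (fpFrom (lo + d)) (lo ∷_) (enum f (suc lo) n) k)
          (trans (count-cong (enum f (suc lo) n) k λ {R} _ → cong (_+ fpFrom (suc lo + d) R)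
                                              (trans (cong (λ t → δ t (lo + d)) (sym (+-identityʳ lo))) (δ-+ lo 0 d)))
                 (count-shift (δ 0 d) (fpFrom (suc lo + d)) (enum f (suc lo) n) k))
  joining : ∀ n → count (fpFrom (lo + d)) (joins f lo n) k ≡ shiftℕ 1 (λ N → joinCount f lo d N k) n
  joining zero    = refl
  joining (suc N) = trans (count-concat (fpFrom (lo + d)) N (joinBlock f lo N) k) (sumℕ-cong N λ i _ →
    count-cartesianProductWith (join lo (N ∸ i)) (fpFrom (lo + d)) (fpFrom (suc (suc (lo + (N ∸ i))) + d))
      (fpFrom (suc lo + suc d)) (δ (suc (N ∸ i)) d) (enum f (suc (suc (lo + (N ∸ i)))) i) (enum f (suc lo) (N ∸ i))
      (λ {B} {A} _ A∈ → fpFrom-join lo d (N ∸ i) B A (𝔐ᴿ-length (enum-sound f (suc lo) (N ∸ i) A∈))) k)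

enumCount-invariant : ∀ f f′ lo lo′ d n k → n < f → n < f′ → enumCount f lo d n k ≡ enumCount f′ lo′ d n k
enumCount-invariant (suc f) (suc f′) lo lo′ d zero    k _ _ = trans (enumCount-zero f lo d k) (sym (enumCount-zero f′ lo′ d k))
enumCount-invariant (suc f) (suc f′) lo lo′ d (suc n) k (s≤s n<f) (s≤s n<f′) =
  trans (enumCount-suc f lo d n k)
        (trans (cong₂ _+_ (shift-cong (δ 0 d) (λ k′ → enumCount-invariant f f′ (suc lo) (suc lo′) d n k′ n<f n<f′) k)
                          (joining n n<f n<f′))
               (sym (enumCount-suc f′ lo′ d n k)))
  where
  joining : ∀ n → n < f → n < f′ →
            shiftℕ 1 (λ N → joinCount f lo d N k) n ≡ shiftℕ 1 (λ N → joinCount f′ lo′ d N k) n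
  joining zero    _ _ = refl
  joining (suc N) N<f N<f′ = sumℕ-cong N λ i i≤N → shift-cong (δ (suc (N ∸ i)) d) (λ k′ → ⊛-cong k′
    (λ j _ → enumCount-invariant f f′ (suc (suc (lo + (N ∸ i)))) (suc (suc (lo′ + (N ∸ i)))) d i j
               (below i≤N N<f) (below i≤N N<f′))
    (λ j _ → enumCount-invariant f f′ (suc lo) (suc lo′) (suc d) (N ∸ i) j
               (below (m∸n≤m N i) N<f) (below (m∸n≤m N i) N<f′))) k
    where
    below : ∀ {m g} → m ≤ N → suc N < g → m < g
    below m≤N = ≤-<-trans (m≤n⇒m≤1+n m≤N)

-- F d n k is the number of π ∈ 𝔐ᴿ_n with exactly k entries π_i = i + d.
F : ℕ → ℕ → ℕ → ℕ
F d n k = enumCount (suc n) 0 d n k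

F-zero : ∀ d k → F d 0 k ≡ δ 0 k
F-zero d k = enumCount-zero 0 0 d k

F-suc : ∀ d n k → F d (suc n) k ≡
  shiftℕ (δ 0 d) (F d n) k +
  shiftℕ 1 (λ N → sumℕ N (λ i → shiftℕ (δ (suc (N ∸ i)) d) (F d i ⊛ F (suc d) (N ∸ i)) k)) n
F-suc d n k =
  trans (enumCount-suc (suc n) 0 d n k)
        (cong₂ _+_ (shift-cong (δ 0 d) (λ k′ → enumCount-invariant (suc n) (suc n) 1 0 d n k′ ≤-refl ≤-refl) k)
                   (joining n ≤-refl))
  where
  joining : ∀ m → m ≤ n → shiftℕ 1 (λ N → joinCount (suc n) 0 d N k) m
                         ≡ shiftℕ 1 (λ N → sumℕ N (λ i → shiftℕ (δ (suc (N ∸ i)) d) (F d i ⊛ F (suc d) (N ∸ i)) k)) m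
  joining zero    _       = refl
  joining (suc N) N<n = sumℕ-cong N λ i i≤N → shift-cong (δ (suc (N ∸ i)) d) (λ k′ → ⊛-cong k′
    (λ j _ → enumCount-invariant (suc n) (suc i) (suc (suc (N ∸ i))) 0 d i j (s≤s (≤-trans (m≤n⇒m≤1+n i≤N) N<n)) ≤-refl)
    (λ j _ → enumCount-invariant (suc n) (suc (N ∸ i)) 1 0 (suc d) (N ∸ i) j
               (s≤s (≤-trans (m≤n⇒m≤1+n (m∸n≤m N i)) N<n)) ≤-refl)) k

∣𝔐ᴿ∣ : ℕ → ℕ
∣𝔐ᴿ∣ n = length (enum (suc n) 0 n)

F-below : ∀ d n k → n ≤ d → F d n k ≡ δ 0 k * ∣𝔐ᴿ∣ n
F-below d n k n≤d =
  trans (count-cong (enum (suc n) 0 n) k (λ π∈ → fpFrom-below d _ λ x∈ →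
           <-≤-trans (proj₂ (Arrangement.bounded (𝔐ᴿ.arranged (enum-sound (suc n) 0 n π∈)) x∈)) n≤d))
        (count-const 0 (enum (suc n) 0 n) k)

∣𝔐ᴿ∣-below : ∀ d n → n ≤ d → F d n 0 ≡ ∣𝔐ᴿ∣ n
∣𝔐ᴿ∣-below d n n≤d = trans (F-below d n 0 n≤d) (*-identityˡ (∣𝔐ᴿ∣ n))

-- With d beyond the length no entry can be a d-shifted fixed point, so F-suc collapses to the Motzkin recurrence.
∣𝔐ᴿ∣-rec : ∀ N → ∣𝔐ᴿ∣ (suc (suc N)) ≡ ∣𝔐ᴿ∣ (suc N) + (∣𝔐ᴿ∣ ⊛ ∣𝔐ᴿ∣) N
∣𝔐ᴿ∣-rec N = begin
  ∣𝔐ᴿ∣ (suc (suc N))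
    ≡⟨ ∣𝔐ᴿ∣-below d (suc (suc N)) ≤-refl ⟨
  F d (suc (suc N)) 0
    ≡⟨ F-suc d (suc N) 0 ⟩
  F d (suc N) 0 + sumℕ N (λ i → shiftℕ (δ (suc (N ∸ i)) d) (F d i ⊛ F (suc d) (N ∸ i)) 0)
    ≡⟨ cong₂ _+_ (∣𝔐ᴿ∣-below d (suc N) (n≤1+n _)) (sumℕ-cong N (λ i i≤N →
         trans (cong (λ t → shiftℕ t (F d i ⊛ F (suc d) (N ∸ i)) 0) (δ-≢ (<⇒≢ (s≤s (s≤s (m∸n≤m N i))))))
               (cong₂ _*_ (∣𝔐ᴿ∣-below d i (≤-trans i≤N (m≤n+m N 2)))
                          (∣𝔐ᴿ∣-below (suc d) (N ∸ i) (≤-trans (m∸n≤m N i) (m≤n+m N 3)))))) ⟩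
  ∣𝔐ᴿ∣ (suc N) + (∣𝔐ᴿ∣ ⊛ ∣𝔐ᴿ∣) N ∎
  where
  open ≡-Reasoning
  d : ℕ
  d = suc (suc N)

∣𝔐ᴿ∣≡Motzkin : ∀ n → ∣𝔐ᴿ∣ n ≡ Motzkin n
∣𝔐ᴿ∣≡Motzkin = Motzkin-unique ∣𝔐ᴿ∣ refl refl ∣𝔐ᴿ∣-rec

F-Motzkin : ∀ j k → F (suc (suc j)) j k ≡ δ 0 k * Motzkin j
F-Motzkin j k = trans (F-below (suc (suc j)) j k (m≤n+m j 2)) (cong (δ 0 k *_) (∣𝔐ᴿ∣≡Motzkin j))

InMR⇒𝔐ᴿ : ∀ {n π} → InMR n π → 𝔐ᴿ 0 n π
InMR⇒𝔐ᴿ {n} (π↭ , ¬231 , ¬32-1) =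
  arrangement (Unique-resp-↭ (setoid ℕ) (↭⇒↭ₛ (↭-sym π↭)) (Uniqueₚ.upTo⁺ n))
              (λ x∈ → z≤n , ∈-upTo⁻ (∈-resp-↭ π↭ x∈))
              (λ x _ x<n → ∈-resp-↭ (↭-sym π↭) (∈-upTo⁺ x<n))
  ⟨ avoids (¬231 ∘ Has231⇒Contains231) (¬32-1 ∘ Has32-1⇒Contains32-1) ⟩

𝔐ᴿ⇒InMR : ∀ {n π} → 𝔐ᴿ 0 n π → InMR n π
𝔐ᴿ⇒InMR {n} {π} (a ⟨ av ⟩) =
  Unique⇒↭ (unique a) (Uniqueₚ.upTo⁺ n) (∈-upTo⁺ ∘ proj₂ ∘ bounded a) (λ x∈ → complete a _ z≤n (∈-upTo⁻ x∈)) ,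
  no231 av ∘ Contains231⇒Has231 π ,
  no32-1 av ∘ Contains32-1⇒Has32-1 π

length-filter : ∀ s k (L : List (List ℕ)) → length (filter (λ π → s π ≟ k) L) ≡ count s L k
length-filter s k []      = refl
length-filter s k (π ∷ L) with does (s π ≟ k)
... | true  = cong suc (length-filter s k L)
... | false = length-filter s k L

HasCount-length : ∀ {P c L} → HasCount P c → Unique L → (∀ π → π ∈ L ⇔ P π) → c ≡ length L
HasCount-length (L′ , u′ , mem′ , refl) u mem =
  ↭-length (Unique⇒↭ u′ u (λ {π} → Equivalence.from (mem π) ∘ Equivalence.to (mem′ π))
                          (λ {π} → Equivalence.from (mem′ π) ∘ Equivalence.to (mem π)))

HasCount⇒F₀ : ∀ {c} n k → HasCount (λ π → InMR n π × fp π ≡ k) c → c ≡ F 0 n k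
HasCount⇒F₀ {c} n k counted =
  trans (HasCount-length counted (Uniqueₚ.filter⁺ fp≟k (enum-unique (suc n) 0 n)) members)
        (length-filter fp k (enum (suc n) 0 n))
  where
  fp≟k : Decidable (λ π → fp π ≡ k)
  fp≟k π = fp π ≟ k
  members : ∀ π → π ∈ filter fp≟k (enum (suc n) 0 n) ⇔ (InMR n π × fp π ≡ k)
  members π = mk⇔ (λ π∈ → let π∈enum , fp≡k = ∈-filter⁻ fp≟k π∈ in 𝔐ᴿ⇒InMR (enum-sound (suc n) 0 n π∈enum) , fp≡k)
                  (λ (inMR , fp≡k) → ∈-filter⁺ fp≟k (enum-complete (suc n) 0 n ≤-refl (InMR⇒𝔐ᴿ inMR)) fp≡k)

theorem2p4 : (a : ℕ → ℕ → ℕ)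
    → (∀ n k → HasCount (λ π → InMR n π × fp π ≡ k) (a n k))
    → Σ[ G ∈ (ℕ → Series) ]
        (((fromℕ² a *ˢ level₀ (G 0)) ≈ˢ oneˢ)
        × (∀ j → (G j *ˢ levelₛ j (G (suc j))) ≈ˢ oneˢ))
theorem2p4 a counts = Fˢ ∘ suc , first-level , levelₛ-inverse
  where
  open ContinuedFraction F F-zero F-suc F-Motzkin
  first-level : (fromℕ² a *ˢ level₀ (Fˢ 1)) ≈ˢ oneˢ
  first-level n k =
    trans (*ˢ-congˡ (level₀ (Fˢ 1)) (λ n k → cong +_ (HasCount⇒F₀ n k (counts n k))) n k) (level₀-inverse n k)
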